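{- For all integers $n,k\ge0$ there is a bijection $g:\mathscr{T}_n^k\to\mathcal{C}_n^k$ with $w_{\mathcal{C}}^{\mathrm{lr}}(g(\lambda))=w_{\mathscr{T}}^{\mathrm{ch}}(\lambda)$ for all $\lambda$; in particular $\sum_{\lambda\in\mathscr{T}_n^k}x^{w_{\mathscr{T}}^{\mathrm{ch}}(\lambda)}=\sum_{\lambda\in\mathcal{C}_n^k}x^{w_{\mathcal{C}}^{\mathrm{lr}}(\lambda)}$.
   Context: Colored symbols $i^r$ (red) and $j^b$ (blue), compared within a color by value. $\mathscr{T}_n^k$ (double alternative trees): pairs $(T_1,T_2)$ of labeled rooted trees whose vertex sets partition $\{0^r,\dots,n^r,0^b,\dots,k^b\}$, roots $0^r$ (of $T_1$) and $0^b$ (of $T_2$), children of red vertices blue and of blue vertices red, and every descendant of a vertex $v$ with the same color as $v$ is larger than $v$. $w_{\mathscr{T}}^{\mathrm{ch}}(\lambda)$ = number of children of $0^r$ that are not leaves. $\mathcal{C}_n^k$ (double Callan permutations): pairs of possibly empty strings $(S_1,S_2)$ using each of $1^r,\dots,n^r,1^b,\dots,k^b$ exactly once in total, with $S_1$ (if nonempty) starting with a blue element, $S_2$ (if nonempty) starting with a red element, and every maximal run of consecutive same-colored elements decreasing. Writing $S_1=B_1R_1\cdots B_\ell R_\ell B_{\ell+1}$ (blue runs $B_i$, red runs $R_i$, $\ell\ge0$, $B_{\ell+1}$ possibly empty), $w_{\mathcal{C}}^{\mathrm{lr}}(\lambda)$ is the number of $i\in\{1,\dots,\ell\}$ with $\min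 B_i<\min B_j$ for all $j<i$. -}

module Defs where

open import Data.Nat using (ℕ; zero; suc; _<_; _≤_; _⊓_; _<ᵇ_; _≡ᵇ_)
open import Data.Bool using (Bool; true; false; if_then_else_; _∧_; _∨_)
open import Data.List using (List; []; _∷_; map; upTo; foldr; _++_; length)
open import Data.Maybe using (Maybe; just; nothing)
open import Data.Product using (_×_; ∃; Σ; _,_)
open import Data.Sum using (_⊎_)
open import Data.Unit using (⊤)
open import Relation.Binary.PropositionalEquality using (_≡_; _≢_)
open import Data.List.Relation.Binary.Permutation.Propositional using (_↭_)

-- Colored symbols  i^r = red i,  j^b = blue j

data Color : Set where
  R B : Color

data Sym : Set where
  red blue : ℕ → Sym

colour : Sym → Color
colour (red _)  = R
colour (blue _) = B

idx : Sym → ℕ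
idx (red i)  = i
idx (blue j) = j

_==_ : Sym → Sym → Bool
red i  == red j  = i ≡ᵇ j
blue i == blue j = i ≡ᵇ j
_      == _      = false

sameCol : Sym → Sym → Bool
sameCol (red _)  (red _)  = true
sameCol (blue _) (blue _) = true
sameCol _        _        = false

isBlue : Sym → Bool
isBlue (blue _) = true
isBlue (red _)  = false

_==ₘ_ : Maybe Sym → Maybe Sym → Bool
just x  ==ₘ just y  = x == y
nothing ==ₘ nothing = true
_       ==ₘ _       = false

oneTo : ℕ → List ℕ
oneTo n = map suc (upTo n)

anyB : {A : Set} → (A → Bool) → List A → Bool
anyB p []       = false
anyB p (x ∷ xs) = p x ∨ anyB p xs

countB : {A : Set} → (A → Bool) → List A → ℕ
countB p []       = 0
countB p (x ∷ xs) = if p x then suc (countB p xs) else countB p xs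

nth : {A : Set} → List A → ℕ → Maybe A
nth []       _       = nothing
nth (x ∷ xs) zero    = just x
nth (x ∷ xs) (suc i) = nth xs i

-- A pair (T1,T2) of rooted labeled (unordered) trees on the vertex set
-- {0^r..n^r, 0^b..k^b} with roots 0^r, 0^b is encoded by its parent map:
-- parR lists the parents of 1^r,...,n^r, parB the parents of 1^b,...,k^b;
-- 0^r and 0^b have no parent.

record Forest : Set where
  constructor forest
  field
    parR : List Sym
    parB : List Sym
open Forest public

InV : ℕ → ℕ → Sym → Set
InV n k (red i)  = i ≤ n
InV n k (blue j) = j ≤ k

parent : Forest → Sym → Maybe Sym
parent F (red zero)     = nothing
parent F (red (suc i))  = nth (parR F) i
parent F (blue zero)    = nothing
parent F (blue (suc j)) = nth (parB F) j

anc : Forest → ℕ → Sym → Maybe Sym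
anc F zero    v = just v
anc F (suc m) v with anc F m v
... | nothing = nothing
... | just u  = parent F u

record IsDAT (n k : ℕ) (F : Forest) : Set where
  field
    lenR      : length (parR F) ≡ n
    lenB      : length (parB F) ≡ k
    parentOK  : ∀ v u → InV n k v → parent F v ≡ just u →
                InV n k u × colour u ≢ colour v
    -- no cycles: every vertex lies in the tree of 0^r or of 0^b
    rooted    : ∀ v → InV n k v →
                ∃ λ m → (anc F m v ≡ just (red 0)) ⊎ (anc F m v ≡ just (blue 0))
    increasing : ∀ v u m → InV n k v → 1 ≤ m → anc F m v ≡ just u →
                 colour u ≡ colour v → idx u < idx v

-- number of children of 0^r that are not leaves
wch : ℕ → ℕ → Forest → ℕ
wch n k F = countB (λ j → (parent F (blue j) ==ₘ just (red 0))
                          ∧ anyB (λ i → parent F (red i) ==ₘ just (blue j)) (oneTo n))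
                   (oneTo k)

allSyms : ℕ → ℕ → List Sym
allSyms n k = map red (oneTo n) ++ map blue (oneTo k)

StartsWith : Color → List Sym → Set
StartsWith c []      = ⊤
StartsWith c (x ∷ _) = colour x ≡ c

RunsDecreasing : List Sym → Set
RunsDecreasing (x ∷ y ∷ xs) = (colour x ≡ colour y → idx y < idx x) × RunsDecreasing (y ∷ xs)
RunsDecreasing _            = ⊤

record IsDCP (n k : ℕ) (S : List Sym × List Sym) : Set where
  constructor isDCP
  field
    perm   : (Data.Product.proj₁ S ++ Data.Product.proj₂ S) ↭ allSyms n k
    start₁ : StartsWith B (Data.Product.proj₁ S)
    start₂ : StartsWith R (Data.Product.proj₂ S)
    dec₁   : RunsDecreasing (Data.Product.proj₁ S)
    dec₂   : RunsDecreasing (Data.Product.proj₂ S)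

consRun : Sym → List (List Sym) → List (List Sym)
consRun x []             = (x ∷ []) ∷ []
consRun x ([] ∷ gs)      = (x ∷ []) ∷ [] ∷ gs
consRun x ((y ∷ g) ∷ gs) =
  if sameCol x y then (x ∷ y ∷ g) ∷ gs else (x ∷ []) ∷ (y ∷ g) ∷ gs

runs : List Sym → List (List Sym)
runs []       = []
runs (x ∷ xs) = consRun x (runs xs)

-- blue runs that are followed by another (hence red) run: B_1,...,B_ℓ
bluesFollowed : List (List Sym) → List (List Sym)
bluesFollowed ((x ∷ g) ∷ h ∷ gs) =
  if isBlue x then (x ∷ g) ∷ bluesFollowed (h ∷ gs) else bluesFollowed (h ∷ gs)
bluesFollowed ([] ∷ h ∷ gs) = bluesFollowed (h ∷ gs)
bluesFollowed _ = []

minRun : List Sym → ℕ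
minRun []       = 0
minRun (x ∷ xs) = foldr _⊓_ (idx x) (map idx xs)

-- number of positions i with a_i < a_j for all j < i
lrMinAux : Maybe ℕ → List ℕ → ℕ
lrMinAux _        []       = 0
lrMinAux nothing  (x ∷ xs) = suc (lrMinAux (just x) xs)
lrMinAux (just m) (x ∷ xs) =
  if x <ᵇ m then suc (lrMinAux (just x) xs) else lrMinAux (just m) xs

wlr : List Sym × List Sym → ℕ
wlr (S₁ , S₂) = lrMinAux nothing (map minRun (bluesFollowed (runs S₁)))

{-# OPTIONS --safe #-}
-- Join the two trees into one tree rooted at 0^r by making 0^b a child of 0^r, and join a double
-- Callan permutation (S₁ , S₂) into the single word S₁ 0^b S₂. A word is decoded into a tree by
-- inserting its letters from left to right along the spine, the path of smallest children from
-- 0^r: each letter becomes the smallest child of the first spine vertex of the other colour whose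
-- smallest child is larger. Decoding is injective, because the last letter is the end of the spine,
-- and onto, because removing the end of the spine and decoding the smaller tree can be undone by
-- re-inserting it. So sending a forest to the unique candidate word that decodes to it (found by
-- finite search) is a bijection. Along the decoding, the blue run ends that are left-to-right minima
-- stay in step with the blue children of 0^r that have a red child; 0^b accounts for one on each
-- side exactly when S₂ is nonempty.
module Submission where

open import Defs
open import Data.Bool using (Bool; true; false; if_then_else_; _∧_; _∨_; not; T)
open import Data.Bool.Properties using (T-≡; ∧-zeroʳ; ∨-zeroʳ; ∧-identityʳ)
open import Data.Empty using (⊥-elim)
open import Data.List using (List; []; _∷_; map; upTo; foldr; foldl; _++_; length; _∷ʳ_; applyUpTo; concatMap; last; filter)
open import Data.List.Properties using (foldl-∷ʳ; ++-identityʳ; ++-conicalˡ; ∷-injective; ++-assoc)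
open import Data.List.Extrema.Nat using (argmin; argmin-sel; f[argmin]≤f[⊤]; f[argmin]≤f[xs]; max; xs≤max)
open import Data.List.Reverse using (Reverse; []; _∶_∶ʳ_; reverseView)
import Data.List.Properties as LP
open import Data.List.Membership.Propositional using (_∈_; _∉_; find; lose)
open import Data.List.Membership.Propositional.Properties
  using (∈-filter⁺; ∈-filter⁻; ∈-map⁺; ∈-map⁻; ∈-upTo⁺; ∈-upTo⁻; ∈-concatMap⁺; ∈-concatMap⁻;
         ∈-∃++; ∈-++⁺ˡ; ∈-++⁺ʳ; ∈-++⁻)
open import Data.List.Relation.Binary.Permutation.Propositional using (_↭_; ↭-refl; ↭-sym; ↭-trans; prep; swap; ↭⇒↭ₛ)
open import Data.List.Relation.Binary.Permutation.Propositional.Properties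
  using (∈-resp-↭; shift; drop-mid; drop-∷; ↭-length; ∷↭∷ʳ)
open import Data.List.Relation.Unary.All using (All; []; _∷_)
import Data.List.Relation.Unary.All as All
import Data.List.Relation.Unary.All.Properties as Allₚ
open import Data.List.Relation.Unary.All.Properties using (¬Any⇒All¬; All¬⇒¬Any)
open import Data.List.Relation.Unary.Any using (Any; here; there)
import Data.List.Relation.Unary.Any as Any
open import Data.List.Relation.Unary.AllPairs using ([]; _∷_)
open import Data.List.Relation.Unary.Unique.Propositional using (Unique)
import Data.List.Relation.Unary.Unique.Propositional.Properties as Uniqueₚ
open import Data.Maybe using (Maybe; just; nothing; fromMaybe; _>>=_)
open import Data.Maybe.Properties using (just-injective; ≡-dec)
open import Data.Nat using (ℕ; zero; suc; _<_; _≤_; _⊓_; _<ᵇ_; _≡ᵇ_; z≤n; s≤s; _+_; _≤?_; _<?_)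
open import Data.Nat.Properties
  using (≡ᵇ⇒≡; ≡⇒≡ᵇ; <ᵇ⇒<; <⇒<ᵇ; ≮⇒≥; <-asym; _≟_; <-irrefl; ≤-refl; <-trans; <-≤-trans; ≤-<-trans; ≰⇒>; <⇒≤; <⇒≱; ≤-antisym;
         ≤∧≢⇒<; suc-injective; +-suc; +-monoˡ-≤; +-comm; +-identityʳ; +-cancelˡ-≡; m≤n+m; ⊓-comm; ⊓-assoc; m≤n⇒m⊓n≡m)
open import Data.Product using (_×_; ∃; Σ; _,_; proj₁; proj₂; map₁)
open import Data.Sum using (_⊎_; inj₁; inj₂; [_,_]′; map₂)
open import Data.Unit using (⊤; tt)
open import Function.Base using (_∘_; case_of_)
open import Function.Bundles using (Equivalence)
open import Relation.Binary.PropositionalEquality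
  using (_≡_; _≢_; refl; sym; trans; cong; cong₂; subst; module ≡-Reasoning) renaming (setoid to ≡-setoid)
open ≡-Reasoning
open import Data.List.Relation.Binary.Permutation.Setoid.Properties (≡-setoid Sym) using (Unique-resp-↭)
open import Relation.Nullary using (¬_; Dec; yes; no)
open import Relation.Nullary.Decidable using (_×-dec_; _→-dec_; map′)

_≟ˢ_ : (a b : Sym) → Dec (a ≡ b)
red i ≟ˢ red j = map′ (cong red) (λ { refl → refl }) (i ≟ j)
blue i ≟ˢ blue j = map′ (cong blue) (λ { refl → refl }) (i ≟ j)
red i ≟ˢ blue j = no λ ()
blue i ≟ˢ red j = no λ ()

_≟ᶜ_ : (a b : Color) → Dec (a ≡ b)
R ≟ᶜ R = yes refl
B ≟ᶜ B = yes refl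
R ≟ᶜ B = no λ ()
B ≟ᶜ R = no λ ()

≢-third⇒≡ : ∀ {a b c : Color} → a ≢ c → b ≢ c → a ≡ b
≢-third⇒≡ {R} {R} _ _ = refl
≢-third⇒≡ {B} {B} _ _ = refl
≢-third⇒≡ {R} {B} {R} a≢c _ = ⊥-elim (a≢c refl)
≢-third⇒≡ {R} {B} {B} _ b≢c = ⊥-elim (b≢c refl)
≢-third⇒≡ {B} {R} {R} _ b≢c = ⊥-elim (b≢c refl)
≢-third⇒≡ {B} {R} {B} a≢c _ = ⊥-elim (a≢c refl)

≢-≢⇒≡ : ∀ {a b c : Color} → a ≢ b → b ≢ c → a ≡ c
≢-≢⇒≡ a≢b b≢c = ≢-third⇒≡ a≢b (λ c≡b → b≢c (sym c≡b))

Sym-≡ : ∀ {a b : Sym} → colour a ≡ colour b → idx a ≡ idx b → a ≡ b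
Sym-≡ {red i} {red .i} refl refl = refl
Sym-≡ {blue i} {blue .i} refl refl = refl

≡ᵇ-true⇒≡ : ∀ {m n} → (m ≡ᵇ n) ≡ true → m ≡ n
≡ᵇ-true⇒≡ {m} {n} e = ≡ᵇ⇒≡ m n (Equivalence.from T-≡ e)

≡ᵇ-refl : ∀ n → (n ≡ᵇ n) ≡ true
≡ᵇ-refl n = Equivalence.to T-≡ (≡⇒≡ᵇ n n refl)

<ᵇ-true⇒< : ∀ {m n} → (m <ᵇ n) ≡ true → m < n
<ᵇ-true⇒< {m} {n} e = <ᵇ⇒< m n (Equivalence.from T-≡ e)

<⇒<ᵇ-true : ∀ {m n} → m < n → (m <ᵇ n) ≡ true
<⇒<ᵇ-true m<n = Equivalence.to T-≡ (<⇒<ᵇ m<n)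

<ᵇ-false⇒≥ : ∀ {m n} → (m <ᵇ n) ≡ false → n ≤ m
<ᵇ-false⇒≥ {m} {n} e = ≮⇒≥ (λ m<n → subst T e (<⇒<ᵇ m<n))

>⇒<ᵇ-false : ∀ {m n} → n < m → (m <ᵇ n) ≡ false
>⇒<ᵇ-false {m} {n} n<m with m <ᵇ n in e
... | false = refl
... | true = ⊥-elim (<-asym n<m (<ᵇ-true⇒< e))

==⇒≡ : ∀ {a b} → (a == b) ≡ true → a ≡ b
==⇒≡ {red i} {red j} e = cong red (≡ᵇ-true⇒≡ e)
==⇒≡ {blue i} {blue j} e = cong blue (≡ᵇ-true⇒≡ e)

==ₘ⇒≡ : ∀ {a b} → (a ==ₘ b) ≡ true → a ≡ b
==ₘ⇒≡ {just x} {just y} e = cong just (==⇒≡ e)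
==ₘ⇒≡ {nothing} {nothing} _ = refl

==ₘ-refl : ∀ a → (a ==ₘ a) ≡ true
==ₘ-refl (just (red i)) = ≡ᵇ-refl i
==ₘ-refl (just (blue j)) = ≡ᵇ-refl j
==ₘ-refl nothing = refl

≢⇒==ₘ-false : ∀ {a b} → a ≢ b → (a ==ₘ b) ≡ false
≢⇒==ₘ-false {a} {b} a≢b with a ==ₘ b in e
... | true = ⊥-elim (a≢b (==ₘ⇒≡ e))
... | false = refl

sameCol⇒≡ : ∀ a b → sameCol a b ≡ true → colour a ≡ colour b
sameCol⇒≡ (red _) (red _) _ = refl
sameCol⇒≡ (blue _) (blue _) _ = refl

¬sameCol⇒≢ : ∀ a b → sameCol a b ≡ false → colour a ≢ colour b
¬sameCol⇒≢ (red _) (blue _) _ ()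
¬sameCol⇒≢ (blue _) (red _) _ ()

≢⇒¬sameCol : ∀ a b → colour a ≢ colour b → sameCol a b ≡ false
≢⇒¬sameCol (red _) (red _) ne = ⊥-elim (ne refl)
≢⇒¬sameCol (blue _) (blue _) ne = ⊥-elim (ne refl)
≢⇒¬sameCol (red _) (blue _) _ = refl
≢⇒¬sameCol (blue _) (red _) _ = refl

∈-∷ʳ⁻ : ∀ {x y : Sym} xs → x ∈ xs ∷ʳ y → x ∈ xs ⊎ x ≡ y
∈-∷ʳ⁻ xs x∈ with ∈-++⁻ xs x∈
... | inj₁ x∈xs = inj₁ x∈xs
... | inj₂ (here x≡y) = inj₂ x≡y

Unique-∷⁺ : ∀ {x : Sym} {xs} → x ∉ xs → Unique xs → Unique (x ∷ xs)
Unique-∷⁺ {xs = xs} x∉ u = ¬Any⇒All¬ xs x∉ ∷ u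

Unique-↭ : ∀ {xs ys : List Sym} → xs ↭ ys → Unique xs → Unique ys
Unique-↭ p = Unique-resp-↭ (↭⇒↭ₛ p)

Unique-∷ʳ⁻ : ∀ xs {x : Sym} → Unique (xs ∷ʳ x) → Unique xs × x ∉ xs
Unique-∷ʳ⁻ xs {x} u with Unique-↭ (↭-sym (∷↭∷ʳ x xs)) u
... | x∉ ∷ u′ = u′ , All¬⇒¬Any x∉

Unique-∷ʳ⁺ : ∀ xs {x : Sym} → Unique xs → x ∉ xs → Unique (xs ∷ʳ x)
Unique-∷ʳ⁺ xs {x} u x∉ = Unique-↭ (∷↭∷ʳ x xs) (Unique-∷⁺ x∉ u)

Unique-mid⁻ : ∀ {x : Sym} as bs → Unique (as ++ x ∷ bs) → Unique (as ++ bs) × x ∉ as ++ bs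
Unique-mid⁻ {x} as bs u with Unique-↭ (shift x as bs) u
... | x∉ ∷ u′ = u′ , All¬⇒¬Any x∉

Unique-++ˡ : ∀ (xs : List Sym) {ys} → Unique (xs ++ ys) → Unique xs
Unique-++ˡ [] _ = []
Unique-++ˡ (x ∷ xs) (x∉ ∷ u) = Allₚ.++⁻ˡ xs x∉ ∷ Unique-++ˡ xs u

ParentMap : Set
ParentMap = Sym → Maybe Sym

ancestor : ParentMap → ℕ → Sym → Maybe Sym
ancestor q zero v = just v
ancestor q (suc m) v = ancestor q m v >>= q

anc≡ancestor : ∀ F m v → anc F m v ≡ ancestor (parent F) m v
anc≡ancestor F zero v = refl
anc≡ancestor F (suc m) v with anc F m v | anc≡ancestor F m v
... | nothing | e rewrite sym e = refl
... | just u | e rewrite sym e = refl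

ancestor-suc : ∀ q m v → ancestor q (suc m) v ≡ (q v >>= ancestor q m)
ancestor-suc q zero v with q v
... | nothing = refl
... | just u = refl
ancestor-suc q (suc m) v rewrite ancestor-suc q m v with q v
... | nothing = refl
... | just u = refl

ancestor-step : ∀ q m v {u} → ancestor q (suc m) v ≡ just u → ∃ λ p → q v ≡ just p × ancestor q m p ≡ just u
ancestor-step q m v e rewrite ancestor-suc q m v with q v
... | just p = p , refl , e

ancestor-cong : ∀ {q q'} → (∀ v → q v ≡ q' v) → ∀ m v → ancestor q m v ≡ ancestor q' m v
ancestor-cong e zero v = refl
ancestor-cong {q} {q'} e (suc m) v rewrite ancestor-cong e m v with ancestor q' m v
... | nothing = refl
... | just u = e u

ancestor-off-leaf : ∀ {q q' : ParentMap} {x} → (∀ v → q v ≢ just x) → (∀ v → v ≢ x → q' v ≡ q v) →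
                    ∀ m v → v ≢ x → ancestor q' m v ≡ ancestor q m v
ancestor-off-leaf nc agree zero v v≢x = refl
ancestor-off-leaf {q} {q'} nc agree (suc m) v v≢x
  rewrite ancestor-suc q' m v | ancestor-suc q m v | agree v v≢x with q v in qv
... | nothing = refl
... | just u = ancestor-off-leaf nc agree m u (λ { refl → nc v qv })

Alternating : ParentMap → Set
Alternating q = ∀ v u → q v ≡ just u → colour u ≢ colour v

GrandparentsDecrease : ParentMap → Set
GrandparentsDecrease q = ∀ v u g → q v ≡ just u → q u ≡ just g → idx g < idx v

-- Colours alternate along a path, so same-coloured ancestors lie an even number of steps up.
module _ {q : ParentMap} (alternating : Alternating q) (grandparent< : GrandparentsDecrease q) where

  ancestor-≤ : ∀ m v {u} → ancestor q m v ≡ just u → colour u ≡ colour v → idx u ≤ idx v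
  ancestor-< : ∀ m v {u} → ancestor q (suc m) v ≡ just u → colour u ≡ colour v → idx u < idx v

  ancestor-≤ zero v refl _ = ≤-refl
  ancestor-≤ (suc m) v e c = <⇒≤ (ancestor-< m v e c)

  ancestor-< zero v e c with ancestor-step q 0 v e
  ... | p , qv , refl = ⊥-elim (alternating v p qv c)
  ancestor-< (suc m) v {u} e c with ancestor-step q (suc m) v e
  ... | p , qv , e₁ with ancestor-step q m p e₁
  ... | g , qp , e₂ = ≤-<-trans (ancestor-≤ m g e₂ (trans c (sym g~v))) (grandparent< v p g qv qp)
    where
      g~v : colour g ≡ colour v
      g~v = ≢-≢⇒≡ (alternating p g qp) (alternating v p qv)

red₀ blue₀ : Sym
red₀ = red 0
blue₀ = blue 0

_≺_ : Sym → Sym → Set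
a ≺ b = colour a ≡ colour b → idx a < idx b

attachesAt : Sym → Sym → Sym → Bool
attachesAt t x a = not (sameCol t x) ∧ (idx x <ᵇ idx a)

-- Inserting x into the spine t ∷ s: the part of the new spine below t, and the new parent of x.
spineAfter : Sym → Sym → List Sym → List Sym
spineAfter x t [] = x ∷ []
spineAfter x t (a ∷ s) = if attachesAt t x a then x ∷ [] else a ∷ spineAfter x a s

attachPoint : Sym → Sym → List Sym → Sym
attachPoint x t [] = t
attachPoint x t (a ∷ s) = if attachesAt t x a then t else attachPoint x a s

setParent : ParentMap → Sym → Sym → ParentMap
setParent q x p v with v ≟ˢ x
... | yes _ = just p
... | no _ = q v

setParent-self : ∀ q x p → setParent q x p x ≡ just p
setParent-self q x p with x ≟ˢ x
... | yes _ = refl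
... | no x≢x = ⊥-elim (x≢x refl)

setParent-other : ∀ q x p v → v ≢ x → setParent q x p v ≡ q v
setParent-other q x p v v≢x with v ≟ˢ x
... | yes v≡x = ⊥-elim (v≢x v≡x)
... | no _ = refl

setParent-cases : ∀ q x p v → (v ≡ x × setParent q x p v ≡ just p) ⊎ (v ≢ x × setParent q x p v ≡ q v)
setParent-cases q x p v with v ≟ˢ x
... | yes v≡x = inj₁ (v≡x , refl)
... | no v≢x = inj₂ (v≢x , refl)

noParents : ParentMap
noParents _ = nothing

decodeStep : ParentMap × List Sym → Sym → ParentMap × List Sym
decodeStep (q , s) x = setParent q x (attachPoint x red₀ s) , spineAfter x red₀ s

decodeState : List Sym → ParentMap × List Sym
decodeState = foldl decodeStep (noParents , [])

decode : List Sym → ParentMap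
decode w = proj₁ (decodeState w)

spine : List Sym → List Sym
spine w = proj₂ (decodeState w)

decode-∷ʳ : ∀ w x → decode (w ∷ʳ x) ≡ setParent (decode w) x (attachPoint x red₀ (spine w))
decode-∷ʳ w x = cong proj₁ (foldl-∷ʳ decodeStep (noParents , []) x w)

spine-∷ʳ : ∀ w x → spine (w ∷ʳ x) ≡ spineAfter x red₀ (spine w)
spine-∷ʳ w x = cong proj₂ (foldl-∷ʳ decodeStep (noParents , []) x w)

data SmallestChildPath (q : ParentMap) : Sym → List Sym → Set where
  leaf : ∀ {t} → (∀ v → q v ≢ just t) → SmallestChildPath q t []
  step : ∀ {t a s} → q a ≡ just t → (∀ v → q v ≡ just t → idx a ≤ idx v) → SmallestChildPath q a s →
         SmallestChildPath q t (a ∷ s)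

SmallestChildPath-cong : ∀ {q q'} → (∀ v → q v ≡ q' v) → ∀ {t s} → SmallestChildPath q t s → SmallestChildPath q' t s
SmallestChildPath-cong e (leaf nc) = leaf (λ v c → nc v (trans (e v) c))
SmallestChildPath-cong e (step qa mn r) = step (trans (sym (e _)) qa) (λ v c → mn v (trans (e v) c)) (SmallestChildPath-cong e r)

SmallestChildPath-unique : ∀ {q} → Alternating q → ∀ {t s₁ s₂} → SmallestChildPath q t s₁ → SmallestChildPath q t s₂ → s₁ ≡ s₂
SmallestChildPath-unique alt (leaf _) (leaf _) = refl
SmallestChildPath-unique alt (leaf childless) (step qa _ _) = ⊥-elim (childless _ qa)
SmallestChildPath-unique alt (step qa _ _) (leaf childless) = ⊥-elim (childless _ qa)
SmallestChildPath-unique alt (step {a = a₁} qa₁ min₁ r₁) (step {a = a₂} qa₂ min₂ r₂)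
  with Sym-≡ {a₁} {a₂} (≢-third⇒≡ (alt _ _ qa₁ ∘ sym) (alt _ _ qa₂ ∘ sym)) (≤-antisym (min₁ a₂ qa₂) (min₂ a₁ qa₁))
... | refl = cong (a₁ ∷_) (SmallestChildPath-unique alt r₁ r₂)

attachPoint-∈ : ∀ x t s → attachPoint x t s ∈ t ∷ s
attachPoint-∈ x t [] = here refl
attachPoint-∈ x t (a ∷ s) with attachesAt t x a
... | true = here refl
... | false = there (attachPoint-∈ x a s)

lastOf : Sym → List Sym → Sym
lastOf t [] = t
lastOf t (a ∷ s) = lastOf a s

lastOf-∷ʳ : ∀ t s y → lastOf t (s ∷ʳ y) ≡ y
lastOf-∷ʳ t [] y = refl
lastOf-∷ʳ t (a ∷ s) y = lastOf-∷ʳ a s y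

last-∷ : ∀ (t : Sym) s → last (t ∷ s) ≡ just (lastOf t s)
last-∷ t [] = refl
last-∷ t (a ∷ s) = last-∷ a s

last-∷ʳ : ∀ (s : List Sym) y → last (s ∷ʳ y) ≡ just y
last-∷ʳ [] y = refl
last-∷ʳ (a ∷ s) y = trans (last-∷ a (s ∷ʳ y)) (cong just (lastOf-∷ʳ a s y))

last≡nothing⇒[] : ∀ (s : List Sym) → last s ≡ nothing → s ≡ []
last≡nothing⇒[] [] _ = refl
last≡nothing⇒[] (a ∷ s) e with trans (sym (last-∷ a s)) e
... | ()

last≡just⇒∷ʳ : ∀ (s : List Sym) {y} → last s ≡ just y → ∃ λ s′ → s ≡ s′ ∷ʳ y
last≡just⇒∷ʳ s e with reverseView s
... | [] with e
...   | ()
last≡just⇒∷ʳ _ e | s′ ∶ _ ∶ʳ y with trans (sym (last-∷ʳ s′ y)) e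
... | refl = s′ , refl

∧-true : ∀ {a b} → (a ∧ b) ≡ true → a ≡ true × b ≡ true
∧-true {true} {true} _ = refl , refl

∧-false : ∀ {a b} → (a ∧ b) ≡ false → a ≡ false ⊎ b ≡ false
∧-false {false} _ = inj₁ refl
∧-false {true} {false} _ = inj₂ refl

not-true : ∀ {a} → not a ≡ true → a ≡ false
not-true {false} _ = refl

not-false : ∀ {a} → not a ≡ false → a ≡ true
not-false {true} _ = refl

setParent-childless : ∀ {q} x p → p ≢ x → (∀ v → q v ≢ just x) → ∀ v → setParent q x p v ≢ just x
setParent-childless {q} x p p≢x childless v e with setParent-cases q x p v
... | inj₁ (_ , e′) = p≢x (just-injective (trans (sym e′) e))
... | inj₂ (_ , e′) = childless v (trans (sym e′) e)

attach-path : ∀ {q} x t → (∀ v → q v ≢ just x) → t ≢ x → (∀ v → q v ≡ just t → idx x ≤ idx v) →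
                   SmallestChildPath (setParent q x t) t (x ∷ [])
attach-path {q} x t childless t≢x below =
  step (setParent-self q x t) smallest (leaf (setParent-childless x t t≢x childless))
  where
    smallest : ∀ v → setParent q x t v ≡ just t → idx x ≤ idx v
    smallest v e with setParent-cases q x t v
    ... | inj₁ (refl , _) = ≤-refl
    ... | inj₂ (_ , e′) = below v (trans (sym e′) e)

spineAfter-path : ∀ {q} x t s → SmallestChildPath q t s → (∀ v → q v ≢ just x) → x ∉ t ∷ s → Unique (t ∷ s) →
                       SmallestChildPath (setParent q x (attachPoint x t s)) t (spineAfter x t s)
spineAfter-path x t [] (leaf noChild) childless x∉ _ =
  attach-path x t childless (x∉ ∘ here ∘ sym) (λ v e → ⊥-elim (noChild v e))
spineAfter-path {q} x t (a ∷ s) (step qa min r) childless x∉ (t∉ ∷ u) with attachesAt t x a in attaches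
... | true = attach-path x t childless (x∉ ∘ here ∘ sym)
               (λ v e → <⇒≤ (<-≤-trans (<ᵇ-true⇒< (proj₂ (∧-true attaches))) (min v e)))
... | false = step (trans (setParent-other q x _ a (x∉ ∘ there ∘ here ∘ sym)) qa) smallest
                   (spineAfter-path x a s r childless (x∉ ∘ there) u)
  where
    smallest : ∀ v → setParent q x (attachPoint x a s) v ≡ just t → idx a ≤ idx v
    smallest v e with setParent-cases q x _ v
    ... | inj₁ (_ , e′) = ⊥-elim (All¬⇒¬Any t∉ (subst (_∈ a ∷ s) (just-injective (trans (sym e′) e)) (attachPoint-∈ x a s)))
    ... | inj₂ (_ , e′) = min v (trans (sym e′) e)

spineAfter-prefix : ∀ x t s → ∃ λ pre → ∃ λ rest →
                    s ≡ pre ++ rest × spineAfter x t s ≡ pre ∷ʳ x × attachPoint x t s ≡ lastOf t pre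
spineAfter-prefix x t [] = [] , [] , refl , refl , refl
spineAfter-prefix x t (a ∷ s) with attachesAt t x a
... | true = [] , a ∷ s , refl , refl , refl
... | false with spineAfter-prefix x a s
...   | pre , rest , e₁ , e₂ , e₃ = a ∷ pre , rest , cong (a ∷_) e₁ , cong (a ∷_) e₂ , e₃

≤∧≢⇒<ˢ : ∀ {a x : Sym} → idx a ≤ idx x → colour a ≡ colour x → a ≢ x → idx a < idx x
≤∧≢⇒<ˢ {a} {x} a≤x c a≢x = ≤∧≢⇒< a≤x (λ e → a≢x (Sym-≡ c e))

attachPoint-valid : ∀ {q} x t s → SmallestChildPath q t s → Alternating q → x ∉ t ∷ s →
                    t ≺ x → (∀ g → q t ≡ just g → g ≺ x) →
                    attachPoint x t s ≺ x × (∀ g → q (attachPoint x t s) ≡ just g → g ≺ x)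
                    × (colour (attachPoint x t s) ≢ colour x ⊎ attachPoint x t s ≡ lastOf t s)
attachPoint-valid x t [] r alt x∉ t≺x parent≺x = t≺x , parent≺x , inj₂ refl
attachPoint-valid {q} x t (a ∷ s) (step qa min r) alt x∉ t≺x parent≺x with attachesAt t x a in attaches
... | true = t≺x , parent≺x , inj₁ (¬sameCol⇒≢ t x (not-true (proj₁ (∧-true attaches))))
... | false = attachPoint-valid x a s r alt (x∉ ∘ there) a≺x (λ g e → subst (_≺ x) (just-injective (trans (sym qa) e)) t≺x)
  where
    a≺x : a ≺ x
    a≺x c with ∧-false attaches
    ... | inj₂ x≮a = ≤∧≢⇒<ˢ (<ᵇ-false⇒≥ x≮a) c (x∉ ∘ there ∘ here ∘ sym)
    ... | inj₁ t~x = ⊥-elim (alt a t qa (trans (sameCol⇒≡ t x (not-false t~x)) (sym c)))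

LastAbove : List Sym → Sym → Set
LastAbove w x = ∀ {y} → last w ≡ just y → colour y ≡ colour x → idx x < idx y

RunsDecreasing-∷ʳ⁻ : ∀ w x → RunsDecreasing (w ∷ʳ x) → RunsDecreasing w × LastAbove w x
RunsDecreasing-∷ʳ⁻ [] x _ = tt , λ ()
RunsDecreasing-∷ʳ⁻ (y ∷ []) x (y>x , _) = tt , λ { refl → y>x }
RunsDecreasing-∷ʳ⁻ (y ∷ z ∷ w) x (z<y , r) = map₁ (z<y ,_) (RunsDecreasing-∷ʳ⁻ (z ∷ w) x r)

RunsDecreasing-∷ʳ⁺ : ∀ w x → RunsDecreasing w → LastAbove w x → RunsDecreasing (w ∷ʳ x)
RunsDecreasing-∷ʳ⁺ [] x _ _ = tt
RunsDecreasing-∷ʳ⁺ (y ∷ []) x _ y>x = y>x refl , tt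
RunsDecreasing-∷ʳ⁺ (y ∷ z ∷ w) x (z<y , r) above = z<y , RunsDecreasing-∷ʳ⁺ (z ∷ w) x r above

StartsWith-∷ʳ⁻ : ∀ {c} w x → StartsWith c (w ∷ʳ x) → (w ≡ [] → colour x ≡ c) × StartsWith c w
StartsWith-∷ʳ⁻ [] x h = (λ _ → h) , tt
StartsWith-∷ʳ⁻ (y ∷ w) x h = (λ ()) , h

StartsWith-∷ʳ⁺ : ∀ {c} w x → (w ≡ [] → colour x ≡ c) → StartsWith c w → StartsWith c (w ∷ʳ x)
StartsWith-∷ʳ⁺ [] x h _ = h refl
StartsWith-∷ʳ⁺ (y ∷ w) x h s = s

record ValidWord (w : List Sym) : Set where
  constructor validWord
  field
    unique     : Unique w
    red₀∉      : red₀ ∉ w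
    decreasing : RunsDecreasing w
    starts     : StartsWith B w

ValidWord-∷ʳ⁻ : ∀ w x → ValidWord (w ∷ʳ x) → ValidWord w
ValidWord-∷ʳ⁻ w x (validWord u r₀∉ rd st) =
  validWord (proj₁ (Unique-∷ʳ⁻ w u)) (r₀∉ ∘ ∈-++⁺ˡ) (proj₁ (RunsDecreasing-∷ʳ⁻ w x rd))
            (proj₂ (StartsWith-∷ʳ⁻ w x st))

ValidWord-last∉ : ∀ w x → ValidWord (w ∷ʳ x) → x ∉ w
ValidWord-last∉ w x v = proj₂ (Unique-∷ʳ⁻ w (ValidWord.unique v))

ValidWord-last≢red₀ : ∀ w x → ValidWord (w ∷ʳ x) → x ≢ red₀
ValidWord-last≢red₀ w x v refl = ValidWord.red₀∉ v (∈-++⁺ʳ w (here refl))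

record IsTree (q : ParentMap) (V : List Sym) : Set where
  field
    dom          : ∀ v u → q v ≡ just u → v ∈ V
    rng          : ∀ v u → q v ≡ just u → u ≡ red₀ ⊎ u ∈ V
    alternating  : Alternating q
    grandparent< : GrandparentsDecrease q
    rooted       : ∀ v → v ∈ V → ∃ λ m → ancestor q m v ≡ just red₀
    root∉        : red₀ ∉ V

module _ {q V} (tree : IsTree q V) where
  open IsTree tree

  IsTree-total : ∀ v → v ∈ V → ∃ λ u → q v ≡ just u
  IsTree-total v v∈ with rooted v v∈
  ... | zero , e = ⊥-elim (root∉ (subst (_∈ V) (just-injective e) v∈))
  ... | suc m , e with ancestor-step q m v e
  ...   | p , qv , _ = p , qv

  IsTree-childless : ∀ {x} → x ∉ V → x ≢ red₀ → ∀ v → q v ≢ just x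
  IsTree-childless x∉ x≢red₀ v e with rng v _ e
  ... | inj₁ x≡red₀ = x≢red₀ x≡red₀
  ... | inj₂ x∈ = x∉ x∈

  IsTree-attach : ∀ {x p} → x ∉ V → x ≢ red₀ → p ≡ red₀ ⊎ p ∈ V → colour p ≢ colour x →
                  (∀ g → q p ≡ just g → g ≺ x) → IsTree (setParent q x p) (V ∷ʳ x)
  IsTree-attach {x} {p} x∉ x≢red₀ p∈ p≁x parent≺x = record
    { dom = dom′ ; rng = rng′ ; alternating = alternating′ ; grandparent< = grandparent<′
    ; rooted = rooted′ ; root∉ = root∉′ }
    where
      q′ = setParent q x p
      childless = IsTree-childless x∉ x≢red₀
      p≢x : p ≢ x
      p≢x refl = p≁x refl
      q′≗q : ∀ v → v ≢ x → q′ v ≡ q v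
      q′≗q = setParent-other q x p
      dom′ : ∀ v u → q′ v ≡ just u → v ∈ V ∷ʳ x
      dom′ v u e with setParent-cases q x p v
      ... | inj₁ (refl , _) = ∈-++⁺ʳ V (here refl)
      ... | inj₂ (_ , e′) = ∈-++⁺ˡ (dom v u (trans (sym e′) e))
      rng′ : ∀ v u → q′ v ≡ just u → u ≡ red₀ ⊎ u ∈ V ∷ʳ x
      rng′ v u e with setParent-cases q x p v
      ... | inj₂ (_ , e′) = map₂ ∈-++⁺ˡ (rng v u (trans (sym e′) e))
      ... | inj₁ (_ , e′) with just-injective (trans (sym e′) e)
      ...   | refl = map₂ ∈-++⁺ˡ p∈
      alternating′ : Alternating q′
      alternating′ v u e with setParent-cases q x p v
      ... | inj₂ (_ , e′) = alternating v u (trans (sym e′) e)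
      ... | inj₁ (refl , e′) with just-injective (trans (sym e′) e)
      ...   | refl = p≁x
      grandparent<′ : GrandparentsDecrease q′
      grandparent<′ v u g e₁ e₂ with setParent-cases q x p v
      ... | inj₂ (v≢x , e′) = grandparent< v u g qv (trans (sym (q′≗q u u≢x)) e₂)
        where
          qv = trans (sym e′) e₁
          u≢x : u ≢ x
          u≢x refl = childless v qv
      ... | inj₁ (refl , e′) with just-injective (trans (sym e′) e₁)
      ...   | refl = parent≺x g qp (≢-≢⇒≡ (alternating p g qp) p≁x)
        where qp = trans (sym (q′≗q p p≢x)) e₂
      rooted′ : ∀ v → v ∈ V ∷ʳ x → ∃ λ m → ancestor q′ m v ≡ just red₀
      rooted′ v v∈ with ∈-∷ʳ⁻ V v∈
      ... | inj₁ v∈V = let (m , e) = rooted v v∈V in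
                       m , trans (ancestor-off-leaf childless q′≗q m v (λ { refl → x∉ v∈V })) e
      ... | inj₂ refl = [ viaRoot , viaParent ]′ p∈
        where
          viaRoot : p ≡ red₀ → ∃ λ m → ancestor q′ m x ≡ just red₀
          viaRoot p≡red₀ = 1 , trans (setParent-self q x p) (cong just p≡red₀)
          viaParent : p ∈ V → ∃ λ m → ancestor q′ m x ≡ just red₀
          viaParent p∈V = let (m , e) = rooted p p∈V in suc m , (begin
            ancestor q′ (suc m) x      ≡⟨ ancestor-suc q′ m x ⟩
            (q′ x >>= ancestor q′ m)   ≡⟨ cong (_>>= ancestor q′ m) (setParent-self q x p) ⟩
            ancestor q′ m p            ≡⟨ ancestor-off-leaf childless q′≗q m p p≢x ⟩
            ancestor q m p             ≡⟨ e ⟩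
            just red₀                  ∎)
      root∉′ : red₀ ∉ V ∷ʳ x
      root∉′ r∈ with ∈-∷ʳ⁻ V r∈
      ... | inj₁ r∈V = root∉ r∈V
      ... | inj₂ r≡x = x≢red₀ (sym r≡x)

red-idx-pos : ∀ x → colour x ≡ R → x ≢ red₀ → 0 < idx x
red-idx-pos (red zero) _ x≢red₀ = ⊥-elim (x≢red₀ refl)
red-idx-pos (red (suc i)) _ _ = s≤s z≤n

record DecodeInvariant (q : ParentMap) (s w : List Sym) : Set where
  field
    tree            : IsTree q w
    spine-path : SmallestChildPath q red₀ s
    spine-⊆         : ∀ a → a ∈ s → a ∈ w
    spine-unique    : Unique s
    spine-last      : last s ≡ last w

Decoded : List Sym → Set
Decoded w = DecodeInvariant (decode w) (spine w) w

decodeInvariant-[] : Decoded []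
decodeInvariant-[] = record
  { tree = record { dom = λ _ _ () ; rng = λ _ _ () ; alternating = λ _ _ () ; grandparent< = λ _ _ _ ()
                  ; rooted = λ _ () ; root∉ = λ () }
  ; spine-path = leaf (λ _ ()) ; spine-⊆ = λ _ () ; spine-unique = [] ; spine-last = refl }

-- The end of the spine is the last letter of w, which x may follow.
spineEnd-colour : ∀ {s w x} → last s ≡ last w → ValidWord (w ∷ʳ x) → lastOf red₀ s ≺ x → colour (lastOf red₀ s) ≢ colour x
spineEnd-colour {s} {w} {x} s~w valid end≺x with last w in lw
... | nothing rewrite last≡nothing⇒[] s s~w = λ R≡x → R≢B (trans R≡x (startsBlue (last≡nothing⇒[] w lw)))
  where
    startsBlue = proj₁ (StartsWith-∷ʳ⁻ w x (ValidWord.starts valid))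
    R≢B : R ≢ B
    R≢B ()
... | just y with last≡just⇒∷ʳ s s~w
...   | s′ , refl rewrite lastOf-∷ʳ red₀ s′ y =
  λ c → <-asym (end≺x c) (proj₂ (RunsDecreasing-∷ʳ⁻ w x (ValidWord.decreasing valid)) lw c)

decodeInvariant-∷ʳ : ∀ {q s} w x → ValidWord (w ∷ʳ x) → DecodeInvariant q s w →
                     DecodeInvariant (setParent q x (attachPoint x red₀ s)) (spineAfter x red₀ s) (w ∷ʳ x)
decodeInvariant-∷ʳ {q} {s} w x valid I = record
  { tree = IsTree-attach tree x∉w x≢red₀ p∈ p≁x (proj₁ (proj₂ attach))
  ; spine-path = spineAfter-path x red₀ s spine-path childless x∉spine
                        (Unique-∷⁺ (root∉ ∘ spine-⊆ red₀) spine-unique)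
  ; spine-⊆ = spine⊆′
  ; spine-unique = subst Unique (sym s′≡) (Unique-∷ʳ⁺ pre (Unique-++ˡ pre (subst Unique s≡ spine-unique))
                     (λ x∈ → x∉w (spine-⊆ x (subst (x ∈_) (sym s≡) (∈-++⁺ˡ x∈)))))
  ; spine-last = trans (cong last s′≡) (trans (last-∷ʳ pre x) (sym (last-∷ʳ w x))) }
  where
    open DecodeInvariant I
    open IsTree tree
    x∉w = ValidWord-last∉ w x valid
    x≢red₀ = ValidWord-last≢red₀ w x valid
    childless = IsTree-childless tree x∉w x≢red₀
    x∉spine : x ∉ red₀ ∷ s
    x∉spine (here x≡red₀) = x≢red₀ x≡red₀
    x∉spine (there x∈) = x∉w (spine-⊆ x x∈)
    p = attachPoint x red₀ s
    p∈ : p ≡ red₀ ⊎ p ∈ w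
    p∈ with attachPoint-∈ x red₀ s
    ... | here p≡red₀ = inj₁ p≡red₀
    ... | there p∈s = inj₂ (spine-⊆ p p∈s)
    attach = attachPoint-valid x red₀ s spine-path alternating x∉spine
               (λ c → red-idx-pos x (sym c) x≢red₀) (λ g e → ⊥-elim (root∉ (dom red₀ g e)))
    p≁x : colour p ≢ colour x
    p≁x with proj₂ (proj₂ attach)
    ... | inj₁ c = c
    ... | inj₂ p≡end = subst (λ z → colour z ≢ colour x) (sym p≡end)
                         (spineEnd-colour {s} {w} {x} spine-last valid (subst (_≺ x) p≡end (proj₁ attach)))
    prefix = spineAfter-prefix x red₀ s
    pre = proj₁ prefix
    s≡ : s ≡ pre ++ proj₁ (proj₂ prefix)
    s≡ = proj₁ (proj₂ (proj₂ prefix))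
    s′≡ : spineAfter x red₀ s ≡ pre ∷ʳ x
    s′≡ = proj₁ (proj₂ (proj₂ (proj₂ prefix)))
    spine⊆′ : ∀ a → a ∈ spineAfter x red₀ s → a ∈ w ∷ʳ x
    spine⊆′ a a∈ with ∈-∷ʳ⁻ pre (subst (a ∈_) s′≡ a∈)
    ... | inj₁ a∈pre = ∈-++⁺ˡ (spine-⊆ a (subst (a ∈_) (sym s≡) (∈-++⁺ˡ a∈pre)))
    ... | inj₂ refl = ∈-++⁺ʳ w (here refl)

decodeInvariant : ∀ w → ValidWord w → Decoded w
decodeInvariant w = go (reverseView w)
  where
    go : ∀ {w} → Reverse w → ValidWord w → Decoded w
    go [] _ = decodeInvariant-[]
    go (w ∶ r ∶ʳ x) valid rewrite decode-∷ʳ w x | spine-∷ʳ w x =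
      decodeInvariant-∷ʳ w x valid (go r (ValidWord-∷ʳ⁻ w x valid))

unsetParent : ParentMap → Sym → ParentMap
unsetParent q x v with v ≟ˢ x
... | yes _ = nothing
... | no _ = q v

unsetParent-other : ∀ q x v → v ≢ x → unsetParent q x v ≡ q v
unsetParent-other q x v v≢x with v ≟ˢ x
... | yes v≡x = ⊥-elim (v≢x v≡x)
... | no _ = refl

unsetParent-cong : ∀ {f g : ParentMap} {x y} → (∀ v → f v ≡ g v) → x ≡ y → ∀ v → unsetParent f x v ≡ unsetParent g y v
unsetParent-cong {x = x} e refl v with v ≟ˢ x
... | yes _ = refl
... | no _ = e v

decode-∷ʳ-unset : ∀ w x → ValidWord (w ∷ʳ x) → ∀ v → decode w v ≡ unsetParent (decode (w ∷ʳ x)) x v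
decode-∷ʳ-unset w x valid v with v ≟ˢ x
... | yes refl with decode w x in e
...   | nothing = refl
...   | just u = ⊥-elim (ValidWord-last∉ w x valid
                   (IsTree.dom (DecodeInvariant.tree (decodeInvariant w (ValidWord-∷ʳ⁻ w x valid))) x u e))
decode-∷ʳ-unset w x valid v | no v≢x = sym (trans (cong (λ f → f v) (decode-∷ʳ w x)) (setParent-other _ x _ v v≢x))

-- The last letter of a word is the end of its spine, which the decoded tree determines.
decode-injective : ∀ w₁ → ValidWord w₁ → ∀ w₂ → ValidWord w₂ → (∀ v → decode w₁ v ≡ decode w₂ v) → w₁ ≡ w₂
decode-injective w₁ v₁ w₂ v₂ = go (reverseView w₁) v₁ (reverseView w₂) v₂
  where
    lastLetters : ∀ {w₁ w₂} → ValidWord w₁ → ValidWord w₂ → (∀ v → decode w₁ v ≡ decode w₂ v) → last w₁ ≡ last w₂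
    lastLetters {w₁} {w₂} v₁ v₂ e = begin
      last w₁        ≡⟨ sym (spine-last I₁) ⟩
      last (spine w₁) ≡⟨ cong last (SmallestChildPath-unique (IsTree.alternating (tree I₂))
                           (SmallestChildPath-cong e (spine-path I₁)) (spine-path I₂)) ⟩
      last (spine w₂) ≡⟨ spine-last I₂ ⟩
      last w₂        ∎
      where
        open DecodeInvariant
        I₁ = decodeInvariant w₁ v₁
        I₂ = decodeInvariant w₂ v₂
    go : ∀ {w₁ w₂} → Reverse w₁ → ValidWord w₁ → Reverse w₂ → ValidWord w₂ →
         (∀ v → decode w₁ v ≡ decode w₂ v) → w₁ ≡ w₂
    go [] _ [] _ _ = refl
    go [] v₁ (w ∶ _ ∶ʳ y) v₂ e with trans (lastLetters v₁ v₂ e) (last-∷ʳ w y)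
    ... | ()
    go (w ∶ _ ∶ʳ x) v₁ [] v₂ e with trans (sym (last-∷ʳ w x)) (lastLetters v₁ v₂ e)
    ... | ()
    go (w ∶ r ∶ʳ x) v₁ (w′ ∶ r′ ∶ʳ y) v₂ e =
      cong₂ _∷ʳ_ (go r (ValidWord-∷ʳ⁻ w x v₁) r′ (ValidWord-∷ʳ⁻ w′ y v₂) e′) x≡y
      where
        x≡y : x ≡ y
        x≡y = just-injective (trans (sym (last-∷ʳ w x)) (trans (lastLetters v₁ v₂ e) (last-∷ʳ w′ y)))
        e′ : ∀ v → decode w v ≡ decode w′ v
        e′ v = trans (decode-∷ʳ-unset w x v₁ v) (trans (unsetParent-cong e x≡y v) (sym (decode-∷ʳ-unset w′ y v₂ v)))

module _ {q V} (tree : IsTree q V) where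
  open IsTree tree

  childOf? : ∀ t v → Dec (q v ≡ just t)
  childOf? t v = ≡-dec _≟ˢ_ (q v) (just t)

  children : Sym → List Sym
  children t = filter (childOf? t) V

  smallestChild : ∀ t → (∀ v → q v ≢ just t) ⊎ ∃ λ a → q a ≡ just t × (∀ v → q v ≡ just t → idx a ≤ idx v)
  smallestChild t with children t in eq
  ... | [] = inj₁ λ v e → case subst (v ∈_) eq (∈-filter⁺ (childOf? t) (dom v t e) e) of λ ()
  ... | c ∷ cs = inj₂ (argmin idx c cs , isChild , smallest)
    where
      child∈ : ∀ {v} → q v ≡ just t → v ∈ c ∷ cs
      child∈ {v} e = subst (v ∈_) eq (∈-filter⁺ (childOf? t) (dom v t e) e)
      isChild : q (argmin idx c cs) ≡ just t
      isChild = proj₂ (∈-filter⁻ (childOf? t) {xs = V}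
                         (subst (argmin idx c cs ∈_) (sym eq) ([ here , there ]′ (argmin-sel idx c cs))))
      smallest : ∀ v → q v ≡ just t → idx (argmin idx c cs) ≤ idx v
      smallest v e with child∈ e
      ... | here refl = f[argmin]≤f[⊤] {f = idx} c cs
      ... | there v∈ = All.lookup (f[argmin]≤f[xs] c cs) v∈

  private
    maxIdx : ℕ
    maxIdx = max 0 (map idx V)

    idx≤maxIdx : ∀ {v} → v ∈ V → idx v ≤ maxIdx
    idx≤maxIdx v∈ = All.lookup (Allₚ.map⁻ (xs≤max 0 (map idx V))) v∈

  -- Each step down the path to a grandchild increases the index, which is bounded by maxIdx.
  smallestChildPath-exists : ∀ t → ∃ (SmallestChildPath q t)
  smallestChildPath-exists t = go (suc maxIdx) t (m≤n+m (suc maxIdx) (idx t))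
    where
      go : ∀ n t → maxIdx < idx t + n → ∃ (SmallestChildPath q t)
      go n t bound with smallestChild t
      ... | inj₁ none = [] , leaf none
      ... | inj₂ (a , qa , minA) with smallestChild a
      ...   | inj₁ none = a ∷ [] , step qa minA (leaf none)
      ...   | inj₂ (b , qb , minB) with n
      ...     | zero = ⊥-elim (<-irrefl refl (<-trans (grandparent< b a t qb qa)
                                 (≤-<-trans (idx≤maxIdx (dom b a qb)) (subst (maxIdx <_) (+-identityʳ (idx t)) bound))))
      ...     | suc n′ with go n′ b (<-≤-trans bound (subst (_≤ idx b + n′) (sym (+-suc (idx t) n′))
                                                            (+-monoˡ-≤ n′ (grandparent< b a t qb qa))))
      ...       | s , r = a ∷ b ∷ s , step qa minA (step qb minB r)

SmallestChildPath-end : ∀ {q t} s₀ {x} → SmallestChildPath q t (s₀ ∷ʳ x) → q x ≡ just (lastOf t s₀) × (∀ v → q v ≢ just x)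
SmallestChildPath-end [] (step qx _ (leaf childless)) = qx , childless
SmallestChildPath-end (a ∷ s₀) (step _ _ r) = SmallestChildPath-end s₀ r

SmallestChildPath-ancestors : ∀ {q t} s₀ {x} → SmallestChildPath q t (s₀ ∷ʳ x) →
                          All (λ e → ∃ λ m → ancestor q (suc m) x ≡ just e) (t ∷ s₀)
SmallestChildPath-ancestors [] (step qx _ _) = (0 , qx) ∷ []
SmallestChildPath-ancestors {q} (a ∷ s₀) (step qa _ r) with SmallestChildPath-ancestors s₀ r
... | (m , e) ∷ above = (suc m , trans (cong (_>>= q) e) qa) ∷ (m , e) ∷ above

SmallestChildPath-lastOf : ∀ {q t s} → SmallestChildPath q t s → ∃ λ m → ancestor q m (lastOf t s) ≡ just t
SmallestChildPath-lastOf (leaf _) = 0 , refl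
SmallestChildPath-lastOf {q} (step qa _ r) with SmallestChildPath-lastOf r
... | m , e = suc m , trans (cong (_>>= q) e) qa

SmallestChildPath-suffix : ∀ {q t} s {a r} → SmallestChildPath q t (s ++ a ∷ r) → SmallestChildPath q a r
SmallestChildPath-suffix [] (step _ _ r) = r
SmallestChildPath-suffix (b ∷ s) (step _ _ r) = SmallestChildPath-suffix s r

last-++-∷ : ∀ (s : List Sym) a r → last (s ++ a ∷ r) ≡ just (lastOf a r)
last-++-∷ [] a r = last-∷ a r
last-++-∷ (b ∷ []) a r = last-∷ a r
last-++-∷ (b ∷ c ∷ s) a r = last-++-∷ (c ∷ s) a r

last≡just⇒lastOf : ∀ t (s : List Sym) {y} → last s ≡ just y → lastOf t s ≡ y
last≡just⇒lastOf t s e with last≡just⇒∷ʳ s e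
... | s′ , refl = lastOf-∷ʳ t s′ _

unsetParent-just : ∀ q x v {u} → unsetParent q x v ≡ just u → v ≢ x × q v ≡ just u
unsetParent-just q x v e with v ≟ˢ x
... | no v≢x = v≢x , e

Alternating-unset : ∀ {q x} → Alternating q → Alternating (unsetParent q x)
Alternating-unset {q} {x} alt v u e = alt v u (proj₂ (unsetParent-just q x v e))

GrandparentsDecrease-unset : ∀ {q x} → GrandparentsDecrease q → GrandparentsDecrease (unsetParent q x)
GrandparentsDecrease-unset {q} {x} gp v u g e₁ e₂ =
  gp v u g (proj₂ (unsetParent-just q x v e₁)) (proj₂ (unsetParent-just q x u e₂))

∈-mid⁻ : ∀ {v x : Sym} as bs → v ∈ as ++ x ∷ bs → v ≢ x → v ∈ as ++ bs
∈-mid⁻ {x = x} as bs v∈ v≢x with ∈-resp-↭ (shift x as bs) v∈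
... | here v≡x = ⊥-elim (v≢x v≡x)
... | there v∈′ = v∈′

∈-mid⁺ : ∀ {v x : Sym} as bs → v ∈ as ++ bs → v ∈ as ++ x ∷ bs
∈-mid⁺ {x = x} as bs v∈ = ∈-resp-↭ (↭-sym (shift x as bs)) (there v∈)

IsTree-unsetLeaf : ∀ {q x} as bs → IsTree q (as ++ x ∷ bs) → Unique (as ++ x ∷ bs) → (∀ v → q v ≢ just x) →
                   IsTree (unsetParent q x) (as ++ bs)
IsTree-unsetLeaf {q} {x} as bs tree u childless = record
  { dom = λ v u e → let (v≢x , qv) = unsetParent-just q x v e in ∈-mid⁻ as bs (dom v u qv) v≢x
  ; rng = rng′
  ; alternating = Alternating-unset alternating
  ; grandparent< = GrandparentsDecrease-unset grandparent<
  ; rooted = rooted′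
  ; root∉ = root∉ ∘ ∈-mid⁺ as bs }
  where
    open IsTree tree
    rng′ : ∀ v u → unsetParent q x v ≡ just u → u ≡ red₀ ⊎ u ∈ as ++ bs
    rng′ v u e with unsetParent-just q x v e
    ... | _ , qv = map₂ (λ u∈ → ∈-mid⁻ as bs u∈ (λ { refl → childless v qv })) (rng v u qv)
    rooted′ : ∀ v → v ∈ as ++ bs → ∃ λ m → ancestor (unsetParent q x) m v ≡ just red₀
    rooted′ v v∈ with rooted v (∈-mid⁺ as bs v∈)
    ... | m , e = m , trans (ancestor-off-leaf childless (unsetParent-other q x) m v
                              (λ { refl → proj₂ (Unique-mid⁻ as bs u) v∈ })) e

NextAbove : Sym → List Sym → Set
NextAbove x [] = ⊤
NextAbove x (b ∷ _) = colour b ≡ colour x × idx x < idx b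

-- Removing the end x of the spine and re-inserting it puts x back under its old parent; the new
-- spine agrees with the old one down to that parent.
reinsert-spine : ∀ {q x} → Alternating q → ∀ t s₀ s → SmallestChildPath q t (s₀ ∷ʳ x) → SmallestChildPath (unsetParent q x) t s →
                 All (_≺ x) (t ∷ s₀) → x ∉ t ∷ s₀ →
                 attachPoint x t s ≡ lastOf t s₀ × ∃ λ rest → s ≡ s₀ ++ rest × NextAbove x rest
reinsert-spine alt t [] [] _ _ _ _ = refl , [] , refl , tt
reinsert-spine {q} {x} alt t [] (b ∷ s) (step qx minX _) (step qb′ _ _) _ _ with unsetParent-just q x b qb′
... | b≢x , qb = attaches , b ∷ s , refl , b~x , x<b
  where
    b~x : colour b ≡ colour x
    b~x = ≢-third⇒≡ (alt b t qb ∘ sym) (alt x t qx ∘ sym)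
    x<b : idx x < idx b
    x<b = ≤∧≢⇒<ˢ (minX b qb) (sym b~x) (b≢x ∘ sym)
    attaches : attachPoint x t (b ∷ s) ≡ t
    attaches rewrite ≢⇒¬sameCol t x (alt x t qx) | <⇒<ᵇ-true x<b = refl
reinsert-spine {q} {x} alt t (a ∷ s₀) [] (step qa _ _) (leaf childless) _ x∉ =
  ⊥-elim (childless a (trans (unsetParent-other q x a (x∉ ∘ there ∘ here ∘ sym)) qa))
reinsert-spine {q} {x} alt t (a ∷ s₀) (b ∷ s) (step qa minA r) (step qb′ minB r′) (t≺x ∷ above) x∉
  with unsetParent-just q x b qb′
... | _ , qb with Sym-≡ {b} {a} (≢-third⇒≡ (alt b t qb ∘ sym) (alt a t qa ∘ sym))
                   (≤-antisym (minB a (trans (unsetParent-other q x a (x∉ ∘ there ∘ here ∘ sym)) qa)) (minA b qb))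
... | refl with reinsert-spine alt b s₀ s r r′ above (x∉ ∘ there)
...   | atParent , rest , s≡ , next = trans passes atParent , rest , cong (b ∷_) s≡ , next
  where
    passes : attachPoint x t (b ∷ s) ≡ attachPoint x b s
    passes with sameCol t x in t~x
    ... | true = refl
    ... | false rewrite >⇒<ᵇ-false (All.head above (≢-third⇒≡ (alt b t qb ∘ sym) (¬sameCol⇒≢ t x t~x ∘ sym))) = refl

module _ {q V s₀ x} (tree : IsTree q V) (r : SmallestChildPath q red₀ (s₀ ∷ʳ x)) where
  open IsTree tree

  private
    q′ = unsetParent q x
    parentX = proj₁ (SmallestChildPath-end s₀ r)
    childless = proj₂ (SmallestChildPath-end s₀ r)

  spine-above-end : All (_≺ x) (red₀ ∷ s₀)
  spine-above-end = All.map (λ (m , e) → ancestor-< alternating grandparent< m x e) (SmallestChildPath-ancestors s₀ r)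

  spineEnd∉above : x ∉ red₀ ∷ s₀
  spineEnd∉above x∈ = <-irrefl refl (All.lookup spine-above-end x∈ refl)

  -- The new spine ends at x's old parent or below a sibling b of x with idx x < idx b.
  reinsert-lastAbove : ∀ rest → SmallestChildPath q′ red₀ (s₀ ++ rest) → NextAbove x rest → LastAbove (s₀ ++ rest) x
  reinsert-lastAbove [] _ _ {y} e y~x =
    ⊥-elim (alternating x (lastOf red₀ s₀) parentX
             (trans (cong colour (last≡just⇒lastOf red₀ s₀ (subst (λ z → last z ≡ just y) (++-identityʳ s₀) e))) y~x))
  reinsert-lastAbove (b ∷ rest) r′ (b~x , x<b) {y} e y~x with SmallestChildPath-lastOf (SmallestChildPath-suffix s₀ r′)
  ... | m , anc rewrite just-injective (trans (sym e) (last-++-∷ s₀ b rest)) =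
    <-≤-trans x<b (ancestor-≤ (Alternating-unset alternating) (GrandparentsDecrease-unset grandparent<)
                              m (lastOf b rest) anc (trans b~x (sym y~x)))

  decode-reinsert : ∀ {w} → ValidWord w → x ∉ w → (∀ v → decode w v ≡ q′ v) →
                    ValidWord (w ∷ʳ x) × (∀ v → decode (w ∷ʳ x) v ≡ q v)
  decode-reinsert {w} valid x∉w decode≗ = validWord′ , decode≗′
    where
      open ValidWord valid
      I = decodeInvariant w valid
      spine′ = SmallestChildPath-cong decode≗ (DecodeInvariant.spine-path I)
      reinserted = reinsert-spine alternating red₀ s₀ (spine w) r spine′ spine-above-end spineEnd∉above
      rest = proj₁ (proj₂ reinserted)
      spine≡ : spine w ≡ s₀ ++ rest
      spine≡ = proj₁ (proj₂ (proj₂ reinserted))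
      x≢red₀ : x ≢ red₀
      x≢red₀ refl = spineEnd∉above (here refl)
      startsBlue : w ≡ [] → colour x ≡ B
      startsBlue refl with ++-conicalˡ s₀ rest (trans (sym spine≡) (last≡nothing⇒[] (spine w) (DecodeInvariant.spine-last I)))
      ... | refl with colour x in cx
      ...   | B = refl
      ...   | R = ⊥-elim (alternating x red₀ parentX (sym cx))
      lastAbove : LastAbove w x
      lastAbove e = reinsert-lastAbove rest (subst (SmallestChildPath q′ red₀) spine≡ spine′) (proj₂ (proj₂ (proj₂ reinserted)))
                      (trans (cong last (sym spine≡)) (trans (DecodeInvariant.spine-last I) e))
      validWord′ : ValidWord (w ∷ʳ x)
      validWord′ = validWord (Unique-∷ʳ⁺ w unique x∉w)
                             (λ r∈ → [ red₀∉ , x≢red₀ ∘ sym ]′ (∈-∷ʳ⁻ w r∈))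
                             (RunsDecreasing-∷ʳ⁺ w x decreasing lastAbove)
                             (StartsWith-∷ʳ⁺ w x startsBlue starts)
      decode≗′ : ∀ v → decode (w ∷ʳ x) v ≡ q v
      decode≗′ v rewrite decode-∷ʳ w x with setParent-cases (decode w) x (attachPoint x red₀ (spine w)) v
      ... | inj₁ (refl , e) = trans e (trans (cong just (proj₁ reinserted)) (sym parentX))
      ... | inj₂ (v≢x , e) = trans e (trans (decode≗ v) (unsetParent-other q x v v≢x))

  spineEnd∈ : x ∈ V
  spineEnd∈ = dom x _ parentX

decode-surjective : ∀ n V → length V ≡ n → Unique V → ∀ q → IsTree q V →
                    ∃ λ w → ValidWord w × (w ↭ V) × (∀ v → decode w v ≡ q v)
decode-surjective n V len u q tree with smallestChildPath-exists tree red₀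
... | s , r with reverseView s
decode-surjective n V len u q tree | _ , leaf noChild | [] with V
... | [] = [] , validWord [] (λ ()) tt tt , ↭-refl , λ v → sym (noParent v)
  where
    noParent : ∀ v → q v ≡ nothing
    noParent v with q v in e
    ... | nothing = refl
    ... | just u with IsTree.dom tree v u e
    ...   | ()
... | v ∷ _ with IsTree.rooted tree v (here refl)
...   | zero , e = ⊥-elim (IsTree.root∉ tree (here (sym (just-injective e))))
...   | suc m , e with ancestor q m v
...     | just c = ⊥-elim (noChild c e)
decode-surjective zero V len u q tree | _ , r | s₀ ∶ _ ∶ʳ x with V | len | spineEnd∈ tree r
... | [] | _ | ()
decode-surjective (suc n) V len u q tree | _ , r | s₀ ∶ _ ∶ʳ x with ∈-∃++ (spineEnd∈ tree r)
... | as , bs , refl with Unique-mid⁻ as bs u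
...   | u′ , x∉ with decode-surjective n (as ++ bs) len′ u′ (unsetParent q x)
                       (IsTree-unsetLeaf as bs tree u (proj₂ (SmallestChildPath-end s₀ r)))
  where
    len′ : length (as ++ bs) ≡ n
    len′ = suc-injective (trans (sym (↭-length (shift x as bs))) len)
...     | w , valid , w↭ , decode≗ with decode-reinsert tree r valid (x∉ ∘ ∈-resp-↭ w↭) decode≗
...       | valid′ , decode≗′ =
  w ∷ʳ x , valid′ , ↭-trans (↭-sym (∷↭∷ʳ x w)) (↭-trans (prep x w↭) (↭-sym (shift x as bs))) , decode≗′

-- The blue letters followed by a red one: the last, hence smallest, letters of the runs B₁, …, B_ℓ.
blueRunEnds : List Sym → List Sym
blueRunEnds (y ∷ z ∷ w) = if isBlue y ∧ not (isBlue z) then y ∷ blueRunEnds (z ∷ w) else blueRunEnds (z ∷ w)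
blueRunEnds _ = []

runs-∷ : ∀ z w → ∃ λ g → ∃ λ gs → runs (z ∷ w) ≡ (z ∷ g) ∷ gs
runs-∷ z w with runs w
... | [] = [] , [] , refl
... | [] ∷ gs = [] , [] ∷ gs , refl
... | (y ∷ g) ∷ gs with sameCol z y
...   | true = y ∷ g , gs , refl
...   | false = [] , (y ∷ g) ∷ gs , refl

⊓-foldr : ∀ a b L → b ⊓ foldr _⊓_ a L ≡ foldr _⊓_ (b ⊓ a) L
⊓-foldr a b [] = refl
⊓-foldr a b (x ∷ L) = trans (sym (⊓-assoc b x _)) (trans (cong (_⊓ foldr _⊓_ a L) (⊓-comm b x))
                        (trans (⊓-assoc x b _) (cong (x ⊓_) (⊓-foldr a b L))))

minRun-∷-decreasing : ∀ y z g → idx z < idx y → minRun (y ∷ z ∷ g) ≡ minRun (z ∷ g)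
minRun-∷-decreasing y z g z<y =
  trans (⊓-foldr (idx y) (idx z) (map idx g)) (cong (λ m → foldr _⊓_ m (map idx g)) (m≤n⇒m⊓n≡m (<⇒≤ z<y)))

blueRunMinima : ∀ w → RunsDecreasing w → map minRun (bluesFollowed (runs w)) ≡ map idx (blueRunEnds w)
blueRunMinima [] _ = refl
blueRunMinima (y ∷ []) _ = refl
blueRunMinima (y ∷ z ∷ w) (h , rd) with runs-∷ z w | blueRunMinima (z ∷ w) rd
... | g , gs , e | ih rewrite e = go y z g gs h ih
  where
    go : ∀ y z g gs → (colour y ≡ colour z → idx z < idx y) →
         map minRun (bluesFollowed ((z ∷ g) ∷ gs)) ≡ map idx (blueRunEnds (z ∷ w)) →
         map minRun (bluesFollowed (consRun y ((z ∷ g) ∷ gs))) ≡ map idx (blueRunEnds (y ∷ z ∷ w))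
    go (red i) (red j) g [] h ih = ih
    go (red i) (red j) g (_ ∷ _) h ih = ih
    go (blue i) (blue j) g [] h ih = ih
    go (blue i) (blue j) g (_ ∷ _) h ih = trans (cong (_∷ _) (minRun-∷-decreasing (blue i) (blue j) g (h refl))) ih
    go (red i) (blue j) g gs h ih = ih
    go (blue i) (red j) g gs h ih = cong (i ∷_) ih

blueRunEnd : Sym → Sym → List Sym
blueRunEnd y x = if isBlue y ∧ not (isBlue x) then y ∷ [] else []

blueRunEnds-∷ʳ : ∀ a w x → blueRunEnds ((a ∷ w) ∷ʳ x) ≡ blueRunEnds (a ∷ w) ++ blueRunEnd (lastOf a w) x
blueRunEnds-∷ʳ a [] x = refl
blueRunEnds-∷ʳ a (b ∷ w) x with isBlue a ∧ not (isBlue b)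
... | true = cong (a ∷_) (blueRunEnds-∷ʳ b w x)
... | false = blueRunEnds-∷ʳ b w x

runningMin : Maybe ℕ → List ℕ → Maybe ℕ
runningMin m [] = m
runningMin nothing (x ∷ L) = runningMin (just x) L
runningMin (just a) (x ∷ L) = if x <ᵇ a then runningMin (just x) L else runningMin (just a) L

runningMin-++ : ∀ m L1 L2 → runningMin m (L1 ++ L2) ≡ runningMin (runningMin m L1) L2
runningMin-++ m [] L2 = refl
runningMin-++ nothing (x ∷ L1) L2 = runningMin-++ (just x) L1 L2
runningMin-++ (just a) (x ∷ L1) L2 with x <ᵇ a
... | true = runningMin-++ (just x) L1 L2
... | false = runningMin-++ (just a) L1 L2

lrMinAux-++ : ∀ m L1 L2 → lrMinAux m (L1 ++ L2) ≡ lrMinAux m L1 + lrMinAux (runningMin m L1) L2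
lrMinAux-++ m [] L2 = refl
lrMinAux-++ nothing (x ∷ L1) L2 = cong suc (lrMinAux-++ (just x) L1 L2)
lrMinAux-++ (just a) (x ∷ L1) L2 with x <ᵇ a
... | true = cong suc (lrMinAux-++ (just x) L1 L2)
... | false = lrMinAux-++ (just a) L1 L2

lrMinAux-zero : ∀ L → lrMinAux (just 0) L ≡ 0
lrMinAux-zero [] = refl
lrMinAux-zero (x ∷ L) = lrMinAux-zero L

toℕ : Bool → ℕ
toℕ true = 1
toℕ false = 0

countB-cong : ∀ {A : Set} {f g : A → Bool} L → (∀ j → j ∈ L → f j ≡ g j) → countB f L ≡ countB g L
countB-cong [] _ = refl
countB-cong {g = g} (x ∷ L) f≗g rewrite f≗g x (here refl) with g x
... | true = cong suc (countB-cong L (λ j j∈ → f≗g j (there j∈)))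
... | false = countB-cong L (λ j j∈ → f≗g j (there j∈))

countB-∷ : ∀ {A : Set} (f : A → Bool) x L → countB f (x ∷ L) ≡ toℕ (f x) + countB f L
countB-∷ f x L with f x
... | true = refl
... | false = refl

countB-false : ∀ {A : Set} (f : A → Bool) L → (∀ j → f j ≡ false) → countB f L ≡ 0
countB-false f [] _ = refl
countB-false f (x ∷ L) never rewrite never x = countB-false f L never

countB-pointUpdate : ∀ {A : Set} {f f′ : A → Bool} {j₀} L → Unique L → j₀ ∈ L → (∀ j → j ≢ j₀ → f′ j ≡ f j) →
                     (f j₀ ≡ true → f′ j₀ ≡ true) → countB f′ L ≡ countB f L + toℕ (f′ j₀ ∧ not (f j₀))
countB-pointUpdate {f = f} {f′} {j₀} (_ ∷ L) (j₀∉ ∷ _) (here refl) agree mono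
  with countB-cong L (λ j j∈ → agree j (λ { refl → All¬⇒¬Any j₀∉ j∈ }))
... | rest with f j₀ | f′ j₀ | mono
...   | true  | true  | _ = trans (cong suc rest) (sym (+-identityʳ _))
...   | true  | false | up = case up refl of λ ()
...   | false | true  | _ = trans (cong suc rest) (+-comm 1 _)
...   | false | false | _ = trans rest (sym (+-identityʳ _))
countB-pointUpdate {f = f} {f′} (x ∷ L) (x∉ ∷ u) (there j₀∈) agree mono
  rewrite agree x (λ { refl → All¬⇒¬Any x∉ j₀∈ }) with f x
... | true = cong suc (countB-pointUpdate L u j₀∈ agree mono)
... | false = countB-pointUpdate L u j₀∈ agree mono

anyB-cong : ∀ {A : Set} {f g : A → Bool} L → (∀ j → j ∈ L → f j ≡ g j) → anyB f L ≡ anyB g L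
anyB-cong [] _ = refl
anyB-cong (x ∷ L) f≗g = cong₂ _∨_ (f≗g x (here refl)) (anyB-cong L (λ j j∈ → f≗g j (there j∈)))

anyB-false : ∀ {A : Set} (f : A → Bool) L → (∀ j → f j ≡ false) → anyB f L ≡ false
anyB-false f [] _ = refl
anyB-false f (x ∷ L) never rewrite never x = anyB-false f L never

anyB-true : ∀ {A : Set} (f : A → Bool) {i} L → i ∈ L → f i ≡ true → anyB f L ≡ true
anyB-true f (x ∷ L) (here refl) e rewrite e = refl
anyB-true f (x ∷ L) (there i∈) e rewrite anyB-true f L i∈ e = ∨-zeroʳ (f x)

hasRedChild : ℕ → ParentMap → Sym → Bool
hasRedChild n q b = anyB (λ i → q (red i) ==ₘ just b) (oneTo n)

innerRootChild : ℕ → ParentMap → ℕ → Bool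
innerRootChild n q j = (q (blue j) ==ₘ just red₀) ∧ hasRedChild n q (blue j)

-- Index 0 stands for blue₀, the root of the second tree.
innerRootChildren : ℕ → ℕ → ParentMap → ℕ
innerRootChildren n k q = countB (innerRootChild n q) (0 ∷ oneTo k)

leafRootChild : ℕ → ParentMap → Sym → Bool
leafRootChild n q p = isBlue p ∧ ((q p ==ₘ just red₀) ∧ not (hasRedChild n q p))

innerRootChildren-noParents : ∀ n k → innerRootChildren n k noParents ≡ 0
innerRootChildren-noParents n k = countB-false (innerRootChild n noParents) (0 ∷ oneTo k) (λ j → refl)

upTo-suc : ∀ k → 0 ∷ oneTo k ≡ upTo (suc k)
upTo-suc k = cong (0 ∷_) (LP.map-upTo suc k)

blue-injective : ∀ {i j} → blue i ≡ blue j → i ≡ j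
blue-injective refl = refl

red-injective : ∀ {i j} → red i ≡ red j → i ≡ j
red-injective refl = refl

innerRootChildren-setBlue : ∀ n k q j₀ p → q (blue j₀) ≡ nothing → (∀ v → q v ≢ just (blue j₀)) →
                            innerRootChildren n k (setParent q (blue j₀) p) ≡ innerRootChildren n k q
innerRootChildren-setBlue n k q j₀ p fresh childless = countB-cong (0 ∷ oneTo k) unchanged
  where
    q′ = setParent q (blue j₀) p
    redChildren : ∀ j → hasRedChild n q′ (blue j) ≡ hasRedChild n q (blue j)
    redChildren j = anyB-cong (oneTo n) (λ i _ → cong (_==ₘ just (blue j)) (setParent-other q (blue j₀) p (red i) (λ ())))
    unchanged : ∀ j → j ∈ 0 ∷ oneTo k → innerRootChild n q′ j ≡ innerRootChild n q j
    unchanged j _ = byCases (j ≟ j₀)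
      where
        byCases : Dec (j ≡ j₀) → innerRootChild n q′ j ≡ innerRootChild n q j
        byCases (no j≢j₀) = cong₂ _∧_ (cong (_==ₘ just red₀) (setParent-other q (blue j₀) p (blue j) (j≢j₀ ∘ blue-injective)))
                                      (redChildren j)
        byCases (yes refl) = begin
          innerRootChild n q′ j₀                ≡⟨ cong ((q′ (blue j₀) ==ₘ just red₀) ∧_) (trans (redChildren j₀) noRedChild) ⟩
          (q′ (blue j₀) ==ₘ just red₀) ∧ false  ≡⟨ ∧-zeroʳ _ ⟩
          false                                 ≡⟨ cong (λ m → (m ==ₘ just red₀) ∧ hasRedChild n q (blue j₀)) (sym fresh) ⟩
          innerRootChild n q j₀                 ∎
          where
            noRedChild : hasRedChild n q (blue j₀) ≡ false
            noRedChild = anyB-false _ (oneTo n) (λ i → ≢⇒==ₘ-false (childless (red i)))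

innerRootChild-setRed-other : ∀ n q i₀ p j → q (red i₀) ≡ nothing → blue j ≢ p →
                              innerRootChild n (setParent q (red i₀) p) j ≡ innerRootChild n q j
innerRootChild-setRed-other n q i₀ p j fresh j≢p =
  cong₂ _∧_ (cong (_==ₘ just red₀) (setParent-other q (red i₀) p (blue j) (λ ()))) (anyB-cong (oneTo n) (λ i _ → redParent i))
  where
    q′ = setParent q (red i₀) p
    redParent : ∀ i → (q′ (red i) ==ₘ just (blue j)) ≡ (q (red i) ==ₘ just (blue j))
    redParent i = byCases (i ≟ i₀)
      where
        byCases : Dec (i ≡ i₀) → (q′ (red i) ==ₘ just (blue j)) ≡ (q (red i) ==ₘ just (blue j))
        byCases (no i≢i₀) = cong (_==ₘ just (blue j)) (setParent-other q (red i₀) p (red i) (i≢i₀ ∘ red-injective))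
        byCases (yes i≡i₀) = subst (λ z → (q′ (red z) ==ₘ just (blue j)) ≡ (q (red z) ==ₘ just (blue j))) (sym i≡i₀) atI₀
          where
            atI₀ : (q′ (red i₀) ==ₘ just (blue j)) ≡ (q (red i₀) ==ₘ just (blue j))
            atI₀ = trans (cong (_==ₘ just (blue j)) (setParent-self q (red i₀) p))
                         (trans (≢⇒==ₘ-false (j≢p ∘ sym ∘ just-injective)) (cong (_==ₘ just (blue j)) (sym fresh)))

-- A new red leaf below p makes p a non-leaf; this counts exactly when p was a leaf child of red₀.
innerRootChildren-setRed : ∀ n k q i₀ p → i₀ ∈ oneTo n → q (red i₀) ≡ nothing → (∀ j → p ≡ blue j → j < suc k) →
                           innerRootChildren n k (setParent q (red i₀) p) ≡ innerRootChildren n k q + toℕ (leafRootChild n q p)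
innerRootChildren-setRed n k q i₀ (red r) _ fresh _ =
  trans (countB-cong (0 ∷ oneTo k) (λ j _ → innerRootChild-setRed-other n q i₀ (red r) j fresh (λ ()))) (sym (+-identityʳ _))
innerRootChildren-setRed n k q i₀ (blue j₀) i₀∈ fresh inRange = begin
  innerRootChildren n k q′
    ≡⟨ countB-pointUpdate (0 ∷ oneTo k) (subst Unique (sym (upTo-suc k)) (Uniqueₚ.upTo⁺ (suc k)))
                            (subst (j₀ ∈_) (sym (upTo-suc k)) (∈-upTo⁺ (inRange j₀ refl)))
         (λ j j≢j₀ → innerRootChild-setRed-other n q i₀ (blue j₀) j fresh (j≢j₀ ∘ blue-injective)) monotone ⟩
  innerRootChildren n k q + toℕ (innerRootChild n q′ j₀ ∧ not (innerRootChild n q j₀))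
    ≡⟨ cong (λ b → innerRootChildren n k q + toℕ (b ∧ not (innerRootChild n q j₀))) inner′ ⟩
  innerRootChildren n k q + toℕ ((A ∧ true) ∧ not (A ∧ hasRedChild n q (blue j₀)))
    ≡⟨ cong (λ b → innerRootChildren n k q + toℕ b) (newlyInner A (hasRedChild n q (blue j₀))) ⟩
  innerRootChildren n k q + toℕ (leafRootChild n q (blue j₀)) ∎
  where
    q′ = setParent q (red i₀) (blue j₀)
    A = q (blue j₀) ==ₘ just red₀
    nowInner : hasRedChild n q′ (blue j₀) ≡ true
    nowInner = anyB-true _ (oneTo n) i₀∈
                 (trans (cong (_==ₘ just (blue j₀)) (setParent-self q (red i₀) (blue j₀))) (==ₘ-refl (just (blue j₀))))
    inner′ : innerRootChild n q′ j₀ ≡ A ∧ true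
    inner′ = cong₂ _∧_ (cong (_==ₘ just red₀) (setParent-other q (red i₀) (blue j₀) (blue j₀) (λ ()))) nowInner
    monotone : innerRootChild n q j₀ ≡ true → innerRootChild n q′ j₀ ≡ true
    monotone e = trans inner′ (trans (∧-identityʳ A) (proj₁ (∧-true e)))
    newlyInner : ∀ a b → ((a ∧ true) ∧ not (a ∧ b)) ≡ (true ∧ (a ∧ not b))
    newlyInner true b = refl
    newlyInner false b = refl

lastM : List Sym → Maybe Sym
lastM [] = nothing
lastM (a ∷ w) = just (lastOf a w)

blueRunEndᵐ : Maybe Sym → Sym → List Sym
blueRunEndᵐ nothing x = []
blueRunEndᵐ (just y) x = blueRunEnd y x

blueRunEnds-∷ʳᵐ : ∀ w x → blueRunEnds (w ∷ʳ x) ≡ blueRunEnds w ++ blueRunEndᵐ (lastM w) x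
blueRunEnds-∷ʳᵐ [] x = refl
blueRunEnds-∷ʳᵐ (a ∷ w) x = blueRunEnds-∷ʳ a w x

lastM≡last : ∀ w → lastM w ≡ last w
lastM≡last [] = refl
lastM≡last (a ∷ w) = sym (last-∷ a w)

lastM-spine : ∀ w → ValidWord w → lastM w ≡ lastM (spine w)
lastM-spine w valid =
  trans (lastM≡last w) (trans (sym (DecodeInvariant.spine-last (decodeInvariant w valid))) (sym (lastM≡last (spine w))))

lastOf-∈ : ∀ t s → lastOf t s ∈ t ∷ s
lastOf-∈ t [] = here refl
lastOf-∈ t (a ∷ s) = there (lastOf-∈ a s)

SmallestChildPath-parent : ∀ {q t s} → SmallestChildPath q t s → ∀ e → e ∈ s → ∃ λ f → f ∈ t ∷ s × q e ≡ just f
SmallestChildPath-parent (step qa _ r) e (here refl) = _ , here refl , qa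
SmallestChildPath-parent (step qa _ r) e (there m) with SmallestChildPath-parent r e m
... | f , f∈ , qf = f , there f∈ , qf

spineAfter-nonempty : ∀ x t s → ∃ λ d → ∃ λ ds → spineAfter x t s ≡ d ∷ ds
spineAfter-nonempty x t [] = x , [] , refl
spineAfter-nonempty x t (a ∷ s) with attachesAt t x a
... | true = x , [] , refl
... | false = a , spineAfter x a s , refl

-- The running minimum of the blue run ends read so far, seen on the spine: it is the first spine vertex
-- once the spine has length at least two, and otherwise lies above it.
SpineMin : List Sym → Maybe ℕ → Set
SpineMin [] M = M ≡ nothing
SpineMin (b ∷ []) M = M ≡ nothing ⊎ ∃ λ m → M ≡ just m × idx b < m
SpineMin (b ∷ c ∷ r) M = M ≡ just (idx b)

SpineMin-long : ∀ b s M → M ≡ just (idx b) → ∀ x → SpineMin (b ∷ spineAfter x b s) M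
SpineMin-long b s M e x with spineAfter-nonempty x b s
... | d , ds , e′ rewrite e′ = e

InRange : ℕ → ℕ → Sym → Set
InRange n k v = (∀ i → v ≡ red i → i ∈ oneTo n) × (∀ j → v ≡ blue j → j < suc k)

blueMin : List Sym → Maybe ℕ
blueMin w = runningMin nothing (map idx (blueRunEnds w))

blueRecords : List Sym → ℕ
blueRecords w = lrMinAux nothing (map idx (blueRunEnds w))

-- The blue run ends that are left-to-right minima correspond to the blue children of red₀ with a red child.
WeightInvariant : ℕ → ℕ → List Sym → Set
WeightInvariant n k w = SpineMin (spine w) (blueMin w) × (blueRecords w ≡ innerRootChildren n k (decode w))

≢red⇒blue : ∀ b → colour b ≢ R → ∃ λ j → b ≡ blue j
≢red⇒blue (red _) nonempty = ⊥-elim (nonempty refl)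
≢red⇒blue (blue j) nonempty = j , refl

≢blue⇒red : ∀ b → colour b ≢ B → ∃ λ j → b ≡ red j
≢blue⇒red (blue _) nonempty = ⊥-elim (nonempty refl)
≢blue⇒red (red j) nonempty = j , refl

blueRunEndᵐ-blue : ∀ m j₀ → blueRunEndᵐ m (blue j₀) ≡ []
blueRunEndᵐ-blue nothing j₀ = refl
blueRunEndᵐ-blue (just (red _)) j₀ = refl
blueRunEndᵐ-blue (just (blue _)) j₀ = refl

spineMin-insertBlue : ∀ {q} j₀ s M → SmallestChildPath q red₀ s → Alternating q → SpineMin s M →
           (∀ y → lastM s ≡ just y → colour y ≡ B → j₀ < idx y) →
           SpineMin (spineAfter (blue j₀) red₀ s) (runningMin M (map idx (blueRunEndᵐ (lastM s) (blue j₀))))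
spineMin-insertBlue {q} j₀ s M path alt spineMin above rewrite blueRunEndᵐ-blue (lastM s) j₀ = go s path spineMin above
  where
    go : ∀ s → SmallestChildPath q red₀ s → SpineMin s M → (∀ y → lastM s ≡ just y → colour y ≡ B → j₀ < idx y) →
         SpineMin (spineAfter (blue j₀) red₀ s) M
    go [] _ spineMin _ = inj₁ spineMin
    go (b ∷ []) (step qb _ _) spineMin above with j₀ <ᵇ idx b in e
    ... | true with spineMin
    ...   | inj₁ e' = inj₁ e'
    ...   | inj₂ (m , em , lt) = inj₂ (m , em , <-trans (<ᵇ-true⇒< e) lt)
    go (b ∷ []) (step qb _ _) spineMin above | false = ⊥-elim (<-irrefl refl (<-≤-trans (above b refl cb) (<ᵇ-false⇒≥ e)))
      where cb : colour b ≡ B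
            cb with ≢red⇒blue b (λ c → alt b red₀ qb (sym c))
            ... | j , refl = refl
    go (b ∷ c ∷ r) _ spineMin _ with j₀ <ᵇ idx b in e
    ... | true = inj₂ (idx b , spineMin , <ᵇ-true⇒< e)
    ... | false = SpineMin-long b (c ∷ r) _ spineMin (blue j₀)

SmallestChildPath-head : ∀ {q t c r} → SmallestChildPath q t (c ∷ r) → q c ≡ just t
SmallestChildPath-head (step e _ _) = e

spineMin-insertRed : ∀ {q} n k i₀ s M → SmallestChildPath q red₀ s → Alternating q →
          GrandparentsDecrease q → Unique s → red₀ ∉ s → (∀ v → v ∈ s → InRange n k v) → SpineMin s M → s ≢ [] →
          SpineMin (spineAfter (red i₀) red₀ s) (runningMin M (map idx (blueRunEndᵐ (lastM s) (red i₀))))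
          × lrMinAux M (map idx (blueRunEndᵐ (lastM s) (red i₀))) ≡ toℕ (leafRootChild n q (attachPoint (red i₀) red₀ s))
spineMin-insertRed n k i₀ [] M _ _ _ _ _ _ _ nonempty = ⊥-elim (nonempty refl)
spineMin-insertRed n k i₀ (red i ∷ r) M (step qb _ _) alt _ _ _ _ _ _ = ⊥-elim (alt (red i) red₀ qb refl)
spineMin-insertRed {q} n k i₀ (blue jb ∷ []) M (step qb _ (leaf childless)) _ _ _ _ _ spineMin _ = go spineMin
  where
    isLeaf : leafRootChild n q (blue jb) ≡ true
    isLeaf rewrite qb | anyB-false (λ i → q (red i) ==ₘ just (blue jb)) (oneTo n) (λ i → ≢⇒==ₘ-false (childless (red i))) = refl
    go : SpineMin (blue jb ∷ []) M →
         SpineMin (blue jb ∷ red i₀ ∷ []) (runningMin M (jb ∷ [])) × lrMinAux M (jb ∷ []) ≡ toℕ (leafRootChild n q (blue jb))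
    go (inj₁ refl) rewrite isLeaf = refl , refl
    go (inj₂ (m , refl , lt)) rewrite <⇒<ᵇ-true lt | isLeaf = refl , refl
spineMin-insertRed {q} n k i₀ (blue jb ∷ c ∷ r) M (step qb _ path′) alt grandparent< (jb∉ ∷ _) red₀∉s inRange spineMin _ =
  SpineMin-long (blue jb) (c ∷ r) _ (blueMin≡ (lastOf c r) refl) (red i₀) , records
  where
    y = lastOf c r
    jb< : ∀ jy → y ≡ blue jy → jb < jy
    jb< jy y≡ with SmallestChildPath-lastOf path′
    ... | m , anc = subst (λ z → jb < idx z) y≡
                      (≤∧≢⇒<ˢ (ancestor-≤ alt grandparent< m y anc (cong colour (sym y≡))) (cong colour (sym y≡))
                              (λ e → All¬⇒¬Any jb∉ (subst (_∈ c ∷ r) (sym e) (lastOf-∈ c r))))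
    blueMin≡ : ∀ y' → y' ≡ y → runningMin M (map idx (blueRunEnd y' (red i₀))) ≡ just jb
    blueMin≡ (red _) _ = spineMin
    blueMin≡ (blue jy) y≡ rewrite spineMin | >⇒<ᵇ-false (jb< jy (sym y≡)) = refl
    noRecord : ∀ y' → y' ≡ y → lrMinAux M (map idx (blueRunEnd y' (red i₀))) ≡ 0
    noRecord (red _) _ = refl
    noRecord (blue jy) y≡ rewrite spineMin | >⇒<ᵇ-false (jb< jy (sym y≡)) = refl
    notLeaf : leafRootChild n q (attachPoint (red i₀) (blue jb) (c ∷ r)) ≡ false
    notLeaf with i₀ <ᵇ idx c
    ... | true with ≢blue⇒red c (λ c~ → alt c (blue jb) (SmallestChildPath-head path′) (sym c~))
    ...   | ic , refl
      rewrite anyB-true (λ i → q (red i) ==ₘ just (blue jb)) (oneTo n) (proj₁ (inRange (red ic) (there (here refl))) ic refl)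
                        (trans (cong (_==ₘ just (blue jb)) (SmallestChildPath-head path′)) (==ₘ-refl (just (blue jb)))) = ∧-zeroʳ _
    notLeaf | false with SmallestChildPath-parent path′ _ (attachPoint-∈ (red i₀) c r)
    ... | f , f∈ , qf rewrite qf | ≢⇒==ₘ-false {just f} {just red₀} (λ e → red₀∉s (subst (_∈ _) (just-injective e) f∈)) =
      ∧-zeroʳ _
    records : lrMinAux M (map idx (blueRunEndᵐ (lastM (blue jb ∷ c ∷ r)) (red i₀)))
              ≡ toℕ (leafRootChild n q (attachPoint (red i₀) red₀ (blue jb ∷ c ∷ r)))
    records = trans (noRecord y refl) (sym (cong toℕ notLeaf))

module AppendLetter (n k : ℕ) (w : List Sym) (x : Sym) (valid : ValidWord (w ∷ʳ x))
                    (inRange : ∀ v → v ∈ w ∷ʳ x → InRange n k v) where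
    valid′ = ValidWord-∷ʳ⁻ w x valid
    I = decodeInvariant w valid′
    open DecodeInvariant I public
    open IsTree tree public
    s = spine w
    q = decode w
    x∉w : x ∉ w
    x∉w = ValidWord-last∉ w x valid
    x≢red₀ : x ≢ red₀
    x≢red₀ = ValidWord-last≢red₀ w x valid
    fresh : q x ≡ nothing
    fresh with q x in e
    ... | nothing = refl
    ... | just u = ⊥-elim (x∉w (dom x u e))
    childless : ∀ v → q v ≢ just x
    childless = IsTree-childless tree x∉w x≢red₀
    red₀∉s : red₀ ∉ s
    red₀∉s m = root∉ (spine-⊆ red₀ m)
    spineInRange : ∀ v → v ∈ s → InRange n k v
    spineInRange v m = inRange v (∈-++⁺ˡ (spine-⊆ v m))
    lastEq : lastM s ≡ last w
    lastEq = trans (lastM≡last s) spine-last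
    lastAbove : ∀ y → lastM s ≡ just y → colour y ≡ colour x → idx x < idx y
    lastAbove y e = proj₂ (RunsDecreasing-∷ʳ⁻ w x (ValidWord.decreasing valid)) (trans (sym lastEq) e)
    spineNonempty : colour x ≡ R → s ≢ []
    spineNonempty c s≡[] with trans (sym c) (proj₁ (StartsWith-∷ʳ⁻ w x (ValidWord.starts valid))
                                     (last≡nothing⇒[] w (trans (sym lastEq) (cong lastM s≡[]))))
    ... | ()

weightInvariant-∷ʳ : ∀ n k w x → ValidWord (w ∷ʳ x) → (∀ v → v ∈ w ∷ʳ x → InRange n k v) →
                     WeightInvariant n k w → WeightInvariant n k (w ∷ʳ x)
weightInvariant-∷ʳ n k w (blue j₀) valid inRange (spineMin , records≡)
  rewrite spine-∷ʳ w (blue j₀) | decode-∷ʳ w (blue j₀) | blueRunEnds-∷ʳᵐ w (blue j₀)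
        | lastM-spine w (ValidWord-∷ʳ⁻ w (blue j₀) valid)
        | LP.map-++ idx (blueRunEnds w) (blueRunEndᵐ (lastM (spine w)) (blue j₀))
        | runningMin-++ nothing (map idx (blueRunEnds w)) (map idx (blueRunEndᵐ (lastM (spine w)) (blue j₀)))
        | lrMinAux-++ nothing (map idx (blueRunEnds w)) (map idx (blueRunEndᵐ (lastM (spine w)) (blue j₀))) =
  spineMin-insertBlue j₀ s _ spine-path alternating spineMin lastAbove , records
  where
    open AppendLetter n k w (blue j₀) valid inRange
    records : lrMinAux nothing (map idx (blueRunEnds w))
              + lrMinAux (runningMin nothing (map idx (blueRunEnds w))) (map idx (blueRunEndᵐ (lastM s) (blue j₀)))
          ≡ innerRootChildren n k (setParent q (blue j₀) (attachPoint (blue j₀) red₀ s))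
    records rewrite blueRunEndᵐ-blue (lastM s) j₀
                  | innerRootChildren-setBlue n k q j₀ (attachPoint (blue j₀) red₀ s) fresh childless =
      trans (+-identityʳ _) records≡
weightInvariant-∷ʳ n k w (red i₀) valid inRange (spineMin , records≡)
  rewrite spine-∷ʳ w (red i₀) | decode-∷ʳ w (red i₀) | blueRunEnds-∷ʳᵐ w (red i₀)
        | lastM-spine w (ValidWord-∷ʳ⁻ w (red i₀) valid)
        | LP.map-++ idx (blueRunEnds w) (blueRunEndᵐ (lastM (spine w)) (red i₀))
        | runningMin-++ nothing (map idx (blueRunEnds w)) (map idx (blueRunEndᵐ (lastM (spine w)) (red i₀)))
        | lrMinAux-++ nothing (map idx (blueRunEnds w)) (map idx (blueRunEndᵐ (lastM (spine w)) (red i₀))) =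
  proj₁ inserted , records
  where
    open AppendLetter n k w (red i₀) valid inRange
    inserted = spineMin-insertRed n k i₀ s _ spine-path alternating grandparent< spine-unique red₀∉s spineInRange
                                  spineMin (spineNonempty refl)
    attachInRange : ∀ j₀ → attachPoint (red i₀) red₀ s ≡ blue j₀ → j₀ < suc k
    attachInRange j₀ e with attachPoint-∈ (red i₀) red₀ s
    ... | here e' with trans (sym e) e'
    ...   | ()
    attachInRange j₀ e | there m = proj₂ (spineInRange _ m) j₀ e
    records : lrMinAux nothing (map idx (blueRunEnds w))
              + lrMinAux (runningMin nothing (map idx (blueRunEnds w))) (map idx (blueRunEndᵐ (lastM s) (red i₀)))
          ≡ innerRootChildren n k (setParent q (red i₀) (attachPoint (red i₀) red₀ s))
    records rewrite innerRootChildren-setRed n k q i₀ (attachPoint (red i₀) red₀ s)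
                      (proj₁ (inRange (red i₀) (∈-++⁺ʳ w (here refl))) i₀ refl) fresh attachInRange =
      cong₂ _+_ records≡ (proj₂ inserted)

weightInvariant : ∀ n k w → ValidWord w → (∀ v → v ∈ w → InRange n k v) → WeightInvariant n k w
weightInvariant n k w = go (reverseView w)
  where
    go : ∀ {w} → Reverse w → ValidWord w → (∀ v → v ∈ w → InRange n k v) → WeightInvariant n k w
    go [] _ _ = refl , sym (innerRootChildren-noParents n k)
    go (w ∶ r ∶ʳ x) valid inRange =
      weightInvariant-∷ʳ n k w x valid inRange (go r (ValidWord-∷ʳ⁻ w x valid) (λ v m → inRange v (∈-++⁺ˡ m)))

oneTo⁺ : ∀ {i n} → 1 ≤ i → i ≤ n → i ∈ oneTo n
oneTo⁺ {suc j} (s≤s _) le = ∈-map⁺ suc (∈-upTo⁺ le)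

oneTo⁻ : ∀ {i n} → i ∈ oneTo n → 1 ≤ i × i ≤ n
oneTo⁻ i∈ with ∈-map⁻ suc i∈
... | j , j∈ , refl = s≤s z≤n , ∈-upTo⁻ j∈

allSyms⁻ : ∀ n k {v} → v ∈ allSyms n k → (∃ λ i → v ≡ red i × i ∈ oneTo n) ⊎ (∃ λ j → v ≡ blue j × j ∈ oneTo k)
allSyms⁻ n k v∈ with ∈-++⁻ (map red (oneTo n)) v∈
... | inj₁ v∈R = let (i , i∈ , e) = ∈-map⁻ red v∈R in inj₁ (i , e , i∈)
... | inj₂ v∈B = let (j , j∈ , e) = ∈-map⁻ blue v∈B in inj₂ (j , e , j∈)

red∈allSyms : ∀ n k {i} → i ∈ oneTo n → red i ∈ allSyms n k
red∈allSyms n k i∈ = ∈-++⁺ˡ (∈-map⁺ red i∈)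

blue∈allSyms : ∀ n k {j} → j ∈ oneTo k → blue j ∈ allSyms n k
blue∈allSyms n k j∈ = ∈-++⁺ʳ (map red (oneTo n)) (∈-map⁺ blue j∈)

InV⇒ : ∀ n k v → InV n k v → v ≡ red₀ ⊎ v ≡ blue₀ ⊎ v ∈ allSyms n k
InV⇒ n k (red zero) _ = inj₁ refl
InV⇒ n k (red (suc i)) le = inj₂ (inj₂ (red∈allSyms n k (oneTo⁺ (s≤s z≤n) le)))
InV⇒ n k (blue zero) _ = inj₂ (inj₁ refl)
InV⇒ n k (blue (suc j)) le = inj₂ (inj₂ (blue∈allSyms n k (oneTo⁺ (s≤s z≤n) le)))

allSyms⇒InV : ∀ n k {v} → v ∈ allSyms n k → InV n k v
allSyms⇒InV n k v∈ with allSyms⁻ n k v∈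
... | inj₁ (i , refl , i∈) = proj₂ (oneTo⁻ i∈)
... | inj₂ (j , refl , j∈) = proj₂ (oneTo⁻ j∈)

allSyms-idx-pos : ∀ n k {v} → v ∈ allSyms n k → 0 < idx v
allSyms-idx-pos n k v∈ with allSyms⁻ n k v∈
... | inj₁ (i , refl , i∈) = proj₁ (oneTo⁻ i∈)
... | inj₂ (j , refl , j∈) = proj₁ (oneTo⁻ j∈)

red₀∉allSyms : ∀ n k → red₀ ∉ allSyms n k
red₀∉allSyms n k r∈ with allSyms-idx-pos n k r∈
... | ()

blue₀∉allSyms : ∀ n k → blue₀ ∉ allSyms n k
blue₀∉allSyms n k b∈ with allSyms-idx-pos n k b∈
... | ()

InV-joined : ∀ n k {v} → v ≡ red₀ ⊎ v ∈ blue₀ ∷ allSyms n k → InV n k v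
InV-joined n k (inj₁ refl) = z≤n
InV-joined n k (inj₂ (here refl)) = z≤n
InV-joined n k (inj₂ (there v∈)) = allSyms⇒InV n k v∈

InRange-allSyms : ∀ n k v → v ∈ blue₀ ∷ allSyms n k → InRange n k v
InRange-allSyms n k v (here refl) = (λ i ()) , λ { j refl → s≤s z≤n }
InRange-allSyms n k v (there v∈) with allSyms⁻ n k v∈
... | inj₁ (i , refl , i∈) = (λ { i′ refl → i∈ }) , λ j ()
... | inj₂ (j , refl , j∈) = (λ i ()) , λ { j′ refl → s≤s (proj₂ (oneTo⁻ j∈)) }

allSyms-unique : ∀ n k → Unique (allSyms n k)
allSyms-unique n k =
  Uniqueₚ.++⁺ (Uniqueₚ.map⁺ red-injective (oneTo-unique n)) (Uniqueₚ.map⁺ blue-injective (oneTo-unique k)) disjoint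
  where
    oneTo-unique : ∀ m → Unique (oneTo m)
    oneTo-unique m = Uniqueₚ.map⁺ suc-injective (Uniqueₚ.upTo⁺ m)
    disjoint : ∀ {v} → ¬ (v ∈ map red (oneTo n) × v ∈ map blue (oneTo k))
    disjoint (r∈ , b∈) with ∈-map⁻ red r∈ | ∈-map⁻ blue b∈
    ... | _ , _ , refl | _ , _ , ()

nth-just⇒< : ∀ {A : Set} (xs : List A) i {u} → nth xs i ≡ just u → i < length xs
nth-just⇒< (x ∷ xs) zero e = s≤s z≤n
nth-just⇒< (x ∷ xs) (suc i) e = s≤s (nth-just⇒< xs i e)

nth-ext : ∀ {A : Set} (xs ys : List A) → length xs ≡ length ys → (∀ i → i < length xs → nth xs i ≡ nth ys i) → xs ≡ ys
nth-ext [] [] _ _ = refl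
nth-ext (x ∷ xs) (y ∷ ys) l h with h 0 (s≤s z≤n)
... | refl = cong (x ∷_) (nth-ext xs ys (suc-injective l) (λ i lt → h (suc i) (s≤s lt)))

nth-applyUpTo : ∀ {A : Set} (f : ℕ → A) n i → i < n → nth (applyUpTo f n) i ≡ just (f i)
nth-applyUpTo f (suc n) zero _ = refl
nth-applyUpTo f (suc n) (suc i) (s≤s i<n) = nth-applyUpTo (f ∘ suc) n i i<n

nth-applyUpTo-≥ : ∀ {A : Set} (f : ℕ → A) n i → n ≤ i → nth (applyUpTo f n) i ≡ nothing
nth-applyUpTo-≥ f zero i _ = refl
nth-applyUpTo-≥ f (suc n) (suc i) (s≤s n≤i) = nth-applyUpTo-≥ (f ∘ suc) n i n≤i

nth-parentList : ∀ (g : ℕ → Maybe Sym) n i → (∀ j → 1 ≤ j → j ≤ n → ∃ λ u → g j ≡ just u) →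
                 (∀ j → n < j → g j ≡ nothing) →
                 nth (map (fromMaybe red₀ ∘ g) (oneTo n)) i ≡ g (suc i)
nth-parentList g n i defined undefined
  rewrite sym (LP.map-∘ {g = fromMaybe red₀ ∘ g} {f = suc} (upTo n)) | LP.map-upTo (fromMaybe red₀ ∘ g ∘ suc) n
  with suc i ≤? n
... | yes i<n rewrite nth-applyUpTo (fromMaybe red₀ ∘ g ∘ suc) n i i<n with defined (suc i) (s≤s z≤n) i<n
...   | u , e rewrite e = refl
nth-parentList g n i defined undefined | no i≮n
  rewrite nth-applyUpTo-≥ (fromMaybe red₀ ∘ g ∘ suc) n i (≮⇒≥ i≮n) = sym (undefined (suc i) (≰⇒> i≮n))

ancestor-extend : ∀ {q q′ : ParentMap} → (∀ v u → q v ≡ just u → q′ v ≡ just u) →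
                  ∀ m v {r} → ancestor q m v ≡ just r → ancestor q′ m v ≡ just r
ancestor-extend extends zero v e = e
ancestor-extend {q} {q′} extends (suc m) v e with ancestor-step q m v e
... | p , qv , e′ =
  trans (ancestor-suc q′ m v) (trans (cong (_>>= ancestor q′ m) (extends v p qv)) (ancestor-extend extends m p e′))

joinedParent : Forest → ParentMap
joinedParent F = setParent (parent F) blue₀ red₀

IsDAT-dom : ∀ n k F → IsDAT n k F → ∀ v u → parent F v ≡ just u → InV n k v
IsDAT-dom n k F D (red zero) u ()
IsDAT-dom n k F D (red (suc i)) u e = subst (suc i ≤_) (IsDAT.lenR D) (nth-just⇒< (parR F) i e)
IsDAT-dom n k F D (blue zero) u ()
IsDAT-dom n k F D (blue (suc j)) u e = subst (suc j ≤_) (IsDAT.lenB D) (nth-just⇒< (parB F) j e)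

module _ {n k F} (D : IsDAT n k F) where
  open IsDAT D

  private
    q = joinedParent F

    parent⇒joined : ∀ v u → parent F v ≡ just u → q v ≡ just u
    parent⇒joined v u e = trans (setParent-other (parent F) blue₀ red₀ v (λ { refl → case e of λ () })) e

    joined⇒parent : ∀ v u → q v ≡ just u → v ≡ blue₀ × u ≡ red₀ ⊎ parent F v ≡ just u
    joined⇒parent v u e with setParent-cases (parent F) blue₀ red₀ v
    ... | inj₁ (refl , e′) = inj₁ (refl , just-injective (trans (sym e) e′))
    ... | inj₂ (_ , e′) = inj₂ (trans (sym e′) e)

    valid : ∀ v u → parent F v ≡ just u → InV n k u × colour u ≢ colour v
    valid v u e = parentOK v u (IsDAT-dom n k F D v u e) e

    inVertices : ∀ v → InV n k v → v ≢ red₀ → v ∈ blue₀ ∷ allSyms n k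
    inVertices v inV v≢red₀ with InV⇒ n k v inV
    ... | inj₁ v≡red₀ = ⊥-elim (v≢red₀ v≡red₀)
    ... | inj₂ (inj₁ refl) = here refl
    ... | inj₂ (inj₂ v∈) = there v∈

    parent≢red₀ : ∀ v u → parent F v ≡ just u → v ≢ red₀
    parent≢red₀ v u e refl = case e of λ ()

    grandparent< : GrandparentsDecrease q
    grandparent< v u g e₁ e₂ with joined⇒parent v u e₁ | joined⇒parent u g e₂
    ... | inj₁ (refl , refl) | inj₂ ()
    ... | inj₁ (refl , refl) | inj₁ (() , _)
    ... | inj₂ pv | inj₁ (refl , refl) = red-idx-pos v (childOfBlue (proj₂ (valid v blue₀ pv))) (parent≢red₀ v blue₀ pv)
      where
        childOfBlue : ∀ {c} → B ≢ c → c ≡ R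
        childOfBlue {R} _ = refl
        childOfBlue {B} B≢B = ⊥-elim (B≢B refl)
    ... | inj₂ pv | inj₂ pu = increasing v g 2 (IsDAT-dom n k F D v u pv) (s≤s z≤n)
                                (trans (anc≡ancestor F 2 v) (trans (cong (_>>= parent F) pv) pu))
                                (≢-≢⇒≡ (proj₂ (valid u g pu)) (proj₂ (valid v u pv)))

  IsDAT⇒IsTree : IsTree (joinedParent F) (blue₀ ∷ allSyms n k)
  IsDAT⇒IsTree = record
    { dom = λ v u e → [ (λ (v≡ , _) → here v≡) , (λ pv → inVertices v (IsDAT-dom n k F D v u pv) (parent≢red₀ v u pv)) ]′
                        (joined⇒parent v u e)
    ; rng = rng′
    ; alternating = λ v u e → [ (λ { (refl , refl) () }) , (λ pv → proj₂ (valid v u pv)) ]′ (joined⇒parent v u e)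
    ; grandparent< = grandparent<
    ; rooted = rooted′
    ; root∉ = λ { (here ()) ; (there r∈) → red₀∉allSyms n k r∈ } }
    where
      rng′ : ∀ v u → q v ≡ just u → u ≡ red₀ ⊎ u ∈ blue₀ ∷ allSyms n k
      rng′ v u e with joined⇒parent v u e
      ... | inj₁ (_ , u≡red₀) = inj₁ u≡red₀
      ... | inj₂ pv with u ≟ˢ red₀
      ...   | yes u≡red₀ = inj₁ u≡red₀
      ...   | no u≢red₀ = inj₂ (inVertices u (proj₁ (valid v u pv)) u≢red₀)
      rooted′ : ∀ v → v ∈ blue₀ ∷ allSyms n k → ∃ λ m → ancestor q m v ≡ just red₀
      rooted′ v v∈ with IsDAT.rooted D v (InV-joined n k (inj₂ v∈))
      ... | m , inj₁ e = m , ancestor-extend parent⇒joined m v (trans (sym (anc≡ancestor F m v)) e)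
      ... | m , inj₂ e = suc m , trans (cong (_>>= q) (ancestor-extend parent⇒joined m v (trans (sym (anc≡ancestor F m v)) e)))
                                       (setParent-self (parent F) blue₀ red₀)

splitForest : ℕ → ℕ → ParentMap → Forest
splitForest n k q = forest (map (fromMaybe red₀ ∘ q ∘ red) (oneTo n)) (map (fromMaybe red₀ ∘ q ∘ blue) (oneTo k))

module _ {n k q} (tree : IsTree q (blue₀ ∷ allSyms n k)) where
  open IsTree tree

  private
    q′ = unsetParent q blue₀

    defined : ∀ {v} → v ∈ allSyms n k → ∃ λ u → q v ≡ just u
    defined v∈ = IsTree-total tree _ (there v∈)

    undefined : ∀ v → ¬ InV n k v → q v ≡ nothing
    undefined v ¬inV with q v in e
    ... | nothing = refl
    ... | just u with dom v u e
    ...   | here refl = ⊥-elim (¬inV z≤n)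
    ...   | there v∈ = ⊥-elim (¬inV (allSyms⇒InV n k v∈))

  parent-splitForest : ∀ v → parent (splitForest n k q) v ≡ q′ v
  parent-splitForest (red zero) with q red₀ in e
  ... | nothing = refl
  ... | just u = ⊥-elim (root∉ (dom red₀ u e))
  parent-splitForest (blue zero) with blue₀ ≟ˢ blue₀
  ... | yes _ = refl
  ... | no b≢b = ⊥-elim (b≢b refl)
  parent-splitForest (red (suc i)) =
    trans (nth-parentList (q ∘ red) n i (λ j 1≤j j≤n → defined (red∈allSyms n k (oneTo⁺ 1≤j j≤n)))
                                        (λ j n<j → undefined (red j) (<⇒≱ n<j)))
          (sym (unsetParent-other q blue₀ (red (suc i)) (λ ())))
  parent-splitForest (blue (suc j)) =
    trans (nth-parentList (q ∘ blue) k j (λ i 1≤i i≤k → defined (blue∈allSyms n k (oneTo⁺ 1≤i i≤k)))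
                                         (λ i k<i → undefined (blue i) (<⇒≱ k<i)))
          (sym (unsetParent-other q blue₀ (blue (suc j)) (λ ())))

  -- Cutting the edge blue₀ → red₀: a path to red₀ either avoids blue₀ or passes through it.
  split-rooted : ∀ m v → ancestor q m v ≡ just red₀ →
                 ∃ λ m′ → ancestor q′ m′ v ≡ just red₀ ⊎ ancestor q′ m′ v ≡ just blue₀
  split-rooted zero v e = 0 , inj₁ e
  split-rooted (suc m) v e with v ≟ˢ blue₀ | ancestor-step q m v e
  ... | yes refl | _ = 0 , inj₂ refl
  ... | no v≢blue₀ | p , qv , e′ with split-rooted m p e′
  ...   | m′ , reach = suc m′ , subst (λ z → z ≡ just red₀ ⊎ z ≡ just blue₀) (sym step′) reach
    where
      step′ : ancestor q′ (suc m′) v ≡ ancestor q′ m′ p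
      step′ = trans (ancestor-suc q′ m′ v) (cong (_>>= ancestor q′ m′) (trans (unsetParent-other q blue₀ v v≢blue₀) qv))

  IsTree⇒IsDAT : IsDAT n k (splitForest n k q)
  IsTree⇒IsDAT = record
    { lenR = trans (LP.length-map _ (oneTo n)) (trans (LP.length-map suc (upTo n)) (LP.length-upTo n))
    ; lenB = trans (LP.length-map _ (oneTo k)) (trans (LP.length-map suc (upTo k)) (LP.length-upTo k))
    ; parentOK = parentOK′
    ; rooted = rooted′
    ; increasing = increasing′ }
    where
      F = splitForest n k q
      anc≡ : ∀ m v → anc F m v ≡ ancestor q′ m v
      anc≡ m v = trans (anc≡ancestor F m v) (ancestor-cong parent-splitForest m v)
      parentOK′ : ∀ v u → InV n k v → parent F v ≡ just u → InV n k u × colour u ≢ colour v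
      parentOK′ v u _ e with unsetParent-just q blue₀ v (trans (sym (parent-splitForest v)) e)
      ... | _ , qv = InV-joined n k (rng v u qv) , alternating v u qv
      rooted′ : ∀ v → InV n k v → ∃ λ m → (anc F m v ≡ just (red 0)) ⊎ (anc F m v ≡ just (blue 0))
      rooted′ v inV with InV⇒ n k v inV
      ... | inj₁ refl = 0 , inj₁ refl
      ... | inj₂ (inj₁ refl) = 0 , inj₂ refl
      ... | inj₂ (inj₂ v∈) with rooted v (there v∈)
      ...   | m , e with split-rooted m v e
      ...     | m′ , reach = m′ , subst (λ z → z ≡ just red₀ ⊎ z ≡ just blue₀) (sym (anc≡ m′ v)) reach
      increasing′ : ∀ v u m → InV n k v → 1 ≤ m → anc F m v ≡ just u → colour u ≡ colour v → idx u < idx v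
      increasing′ v u (suc m) _ _ e =
        ancestor-< (Alternating-unset alternating) (GrandparentsDecrease-unset grandparent<) m v (trans (sym (anc≡ (suc m) v)) e)

-- blue₀ separates S₁ from S₂; in the joined tree it is the child of red₀.
join : List Sym × List Sym → List Sym
join (S₁ , S₂) = S₁ ++ blue₀ ∷ S₂

RunsDecreasing-tail : ∀ a L → RunsDecreasing (a ∷ L) → RunsDecreasing L
RunsDecreasing-tail a [] _ = tt
RunsDecreasing-tail a (b ∷ L) (_ , r) = r

RunsDecreasing-++ˡ : ∀ As Bs → RunsDecreasing (As ++ Bs) → RunsDecreasing As
RunsDecreasing-++ˡ [] Bs _ = tt
RunsDecreasing-++ˡ (a ∷ []) Bs _ = tt
RunsDecreasing-++ˡ (a ∷ a′ ∷ As) Bs (h , r) = h , RunsDecreasing-++ˡ (a′ ∷ As) Bs r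

RunsDecreasing-++ʳ : ∀ As Bs → RunsDecreasing (As ++ Bs) → RunsDecreasing Bs
RunsDecreasing-++ʳ [] Bs r = r
RunsDecreasing-++ʳ (a ∷ As) Bs r = RunsDecreasing-++ʳ As Bs (RunsDecreasing-tail a (As ++ Bs) r)

blue-idx-pos : ∀ a → a ≢ blue₀ → colour a ≡ B → 0 < idx a
blue-idx-pos (blue zero) a≢blue₀ _ = ⊥-elim (a≢blue₀ refl)
blue-idx-pos (blue (suc j)) _ _ = s≤s z≤n

RunsDecreasing-join : ∀ S₁ S₂ → RunsDecreasing S₁ → RunsDecreasing S₂ → StartsWith R S₂ → blue₀ ∉ S₁ →
                      RunsDecreasing (join (S₁ , S₂))
RunsDecreasing-join [] [] _ _ _ _ = tt
RunsDecreasing-join [] (y ∷ S₂) _ r₂ startsRed _ = (λ B≡ → case trans B≡ startsRed of λ ()) , r₂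
RunsDecreasing-join (a ∷ []) S₂ _ r₂ startsRed b∉ =
  blue-idx-pos a (b∉ ∘ here ∘ sym) , RunsDecreasing-join [] S₂ tt r₂ startsRed (λ ())
RunsDecreasing-join (a ∷ a′ ∷ S₁) S₂ (h , r₁) r₂ startsRed b∉ =
  h , RunsDecreasing-join (a′ ∷ S₁) S₂ r₁ r₂ startsRed (b∉ ∘ there)

join-↭ : ∀ n k S₁ S₂ → S₁ ++ S₂ ↭ allSyms n k → join (S₁ , S₂) ↭ blue₀ ∷ allSyms n k
join-↭ n k S₁ S₂ p = ↭-trans (shift blue₀ S₁ S₂) (prep blue₀ p)

StartsWith-++ˡ : ∀ {c} S₁ rest → StartsWith c (S₁ ++ rest) → StartsWith c S₁
StartsWith-++ˡ [] rest _ = tt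
StartsWith-++ˡ (a ∷ S₁) rest h = h

StartsWith-afterBlue₀ : ∀ S₂ → RunsDecreasing (blue₀ ∷ S₂) → StartsWith R S₂
StartsWith-afterBlue₀ [] _ = tt
StartsWith-afterBlue₀ (red _ ∷ S₂) _ = refl
StartsWith-afterBlue₀ (blue j ∷ S₂) (h , _) = case h refl of λ ()

blue₀∉S₁ : ∀ n k S₁ S₂ → IsDCP n k (S₁ , S₂) → blue₀ ∉ S₁
blue₀∉S₁ n k S₁ S₂ d b∈ = blue₀∉allSyms n k (∈-resp-↭ (IsDCP.perm d) (∈-++⁺ˡ b∈))

IsDCP⇒ValidWord : ∀ n k σ → IsDCP n k σ → ValidWord (join σ)
IsDCP⇒ValidWord n k (S₁ , S₂) d@(isDCP perm start₁ start₂ dec₁ dec₂) =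
  validWord (Unique-↭ (↭-sym joined) (Unique-∷⁺ (blue₀∉allSyms n k) (allSyms-unique n k)))
            (λ r∈ → case ∈-resp-↭ joined r∈ of λ { (there r∈′) → red₀∉allSyms n k r∈′ })
            (RunsDecreasing-join S₁ S₂ dec₁ dec₂ start₂ (blue₀∉S₁ n k S₁ S₂ d))
            (startsBlue S₁ start₁)
  where
    joined = join-↭ n k S₁ S₂ perm
    startsBlue : ∀ S₁ → StartsWith B S₁ → StartsWith B (join (S₁ , S₂))
    startsBlue [] _ = refl
    startsBlue (a ∷ S₁) h = h

ValidWord⇒IsDCP : ∀ n k w → ValidWord w → w ↭ blue₀ ∷ allSyms n k → ∃ λ σ → IsDCP n k σ × join σ ≡ w
ValidWord⇒IsDCP n k w (validWord _ _ dec starts) p with ∈-∃++ (∈-resp-↭ (↭-sym p) (here refl))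
... | S₁ , S₂ , refl =
  (S₁ , S₂) , isDCP (drop-∷ (↭-trans (↭-sym (shift blue₀ S₁ S₂)) p)) (StartsWith-++ˡ S₁ (blue₀ ∷ S₂) starts)
                    (StartsWith-afterBlue₀ S₂ afterS₁) (RunsDecreasing-++ˡ S₁ (blue₀ ∷ S₂) dec)
                    (RunsDecreasing-tail blue₀ S₂ afterS₁)
            , refl
  where
    afterS₁ = RunsDecreasing-++ʳ S₁ (blue₀ ∷ S₂) dec

join-injective : ∀ S₁ S₂ S₁′ S₂′ → blue₀ ∉ S₁ → blue₀ ∉ S₁′ →
                 join (S₁ , S₂) ≡ join (S₁′ , S₂′) → (S₁ , S₂) ≡ (S₁′ , S₂′)
join-injective [] S₂ [] S₂′ _ _ refl = refl
join-injective [] S₂ (a ∷ S₁′) S₂′ _ b∉′ refl = ⊥-elim (b∉′ (here refl))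
join-injective (a ∷ S₁) S₂ [] S₂′ b∉ _ refl = ⊥-elim (b∉ (here refl))
join-injective (a ∷ S₁) S₂ (a′ ∷ S₁′) S₂′ b∉ b∉′ e with ∷-injective e
... | refl , e′ with join-injective S₁ S₂ S₁′ S₂′ (b∉ ∘ there) (b∉′ ∘ there) e′
...   | refl = refl

inserts : Sym → List Sym → List (List Sym)
inserts x [] = (x ∷ []) ∷ []
inserts x (y ∷ ys) = (x ∷ y ∷ ys) ∷ map (y ∷_) (inserts x ys)

permutations : List Sym → List (List Sym)
permutations [] = [] ∷ []
permutations (x ∷ xs) = concatMap (inserts x) (permutations xs)

inserts-↭ : ∀ x ys zs → zs ∈ inserts x ys → zs ↭ x ∷ ys
inserts-↭ x [] zs (here refl) = ↭-refl
inserts-↭ x (y ∷ ys) zs (here refl) = ↭-refl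
inserts-↭ x (y ∷ ys) zs (there zs∈) with ∈-map⁻ (y ∷_) zs∈
... | zs′ , zs′∈ , refl = ↭-trans (prep y (inserts-↭ x ys zs′ zs′∈)) (swap y x ↭-refl)

inserts-complete : ∀ x as bs → as ++ x ∷ bs ∈ inserts x (as ++ bs)
inserts-complete x [] [] = here refl
inserts-complete x [] (b ∷ bs) = here refl
inserts-complete x (a ∷ as) bs = there (∈-map⁺ (a ∷_) (inserts-complete x as bs))

permutations-↭ : ∀ xs zs → zs ∈ permutations xs → zs ↭ xs
permutations-↭ [] zs (here refl) = ↭-refl
permutations-↭ (x ∷ xs) zs zs∈ with find (∈-concatMap⁻ (inserts x) {xs = permutations xs} zs∈)
... | ys , ys∈ , zs∈′ = ↭-trans (inserts-↭ x ys zs zs∈′) (prep x (permutations-↭ xs ys ys∈))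

permutations-complete : ∀ xs zs → zs ↭ xs → zs ∈ permutations xs
permutations-complete [] [] p = here refl
permutations-complete [] (z ∷ zs) p = case ↭-length p of λ ()
permutations-complete (x ∷ xs) zs p with ∈-∃++ (∈-resp-↭ (↭-sym p) (here refl))
... | as , bs , refl = ∈-concatMap⁺ (inserts x) {xs = permutations xs}
                         (lose (permutations-complete xs (as ++ bs) (drop-mid as [] p)) (inserts-complete x as bs))

splits : List Sym → List (List Sym × List Sym)
splits [] = ([] , []) ∷ []
splits (x ∷ xs) = ([] , x ∷ xs) ∷ map (map₁ (x ∷_)) (splits xs)

splits-++ : ∀ L σ → σ ∈ splits L → proj₁ σ ++ proj₂ σ ≡ L
splits-++ [] σ (here refl) = refl
splits-++ (x ∷ L) σ (here refl) = refl
splits-++ (x ∷ L) σ (there σ∈) with ∈-map⁻ (map₁ (x ∷_)) σ∈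
... | σ′ , σ′∈ , refl = cong (x ∷_) (splits-++ L σ′ σ′∈)

splits-complete : ∀ Xs Ys → (Xs , Ys) ∈ splits (Xs ++ Ys)
splits-complete [] [] = here refl
splits-complete [] (b ∷ Ys) = here refl
splits-complete (a ∷ Xs) Ys = there (∈-map⁺ (map₁ (a ∷_)) (splits-complete Xs Ys))

candidates : ℕ → ℕ → List (List Sym × List Sym)
candidates n k = concatMap splits (permutations (allSyms n k))

candidates-↭ : ∀ n k σ → σ ∈ candidates n k → proj₁ σ ++ proj₂ σ ↭ allSyms n k
candidates-↭ n k σ σ∈ with find (∈-concatMap⁻ splits {xs = permutations (allSyms n k)} σ∈)
... | L , L∈ , σ∈′ = subst (_↭ allSyms n k) (sym (splits-++ L σ σ∈′)) (permutations-↭ (allSyms n k) L L∈)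

candidates-complete : ∀ n k S₁ S₂ → S₁ ++ S₂ ↭ allSyms n k → (S₁ , S₂) ∈ candidates n k
candidates-complete n k S₁ S₂ p =
  ∈-concatMap⁺ splits {xs = permutations (allSyms n k)}
               (lose (permutations-complete (allSyms n k) (S₁ ++ S₂) p) (splits-complete S₁ S₂))

startsWith? : ∀ c L → Dec (StartsWith c L)
startsWith? c [] = yes tt
startsWith? c (x ∷ L) = colour x ≟ᶜ c

runsDecreasing? : ∀ L → Dec (RunsDecreasing L)
runsDecreasing? [] = yes tt
runsDecreasing? (x ∷ []) = yes tt
runsDecreasing? (x ∷ y ∷ L) = ((colour x ≟ᶜ colour y) →-dec (idx y <? idx x)) ×-dec runsDecreasing? (y ∷ L)

Encodes : ℕ → ℕ → Forest → List Sym × List Sym → Set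
Encodes n k F σ = All (λ v → parent F v ≡ decode (join σ) v) (allSyms n k)

Good : ℕ → ℕ → Forest → List Sym × List Sym → Set
Good n k F (S₁ , S₂) = (StartsWith B S₁ × StartsWith R S₂ × RunsDecreasing S₁ × RunsDecreasing S₂) × Encodes n k F (S₁ , S₂)

good? : ∀ n k F σ → Dec (Good n k F σ)
good? n k F (S₁ , S₂) =
  (startsWith? B S₁ ×-dec startsWith? R S₂ ×-dec runsDecreasing? S₁ ×-dec runsDecreasing? S₂)
  ×-dec All.all? (λ v → ≡-dec _≟ˢ_ (parent F v) (decode (join (S₁ , S₂)) v)) (allSyms n k)

-- The bijection is defined by search: the candidate that decodes to the given forest.
encode : ℕ → ℕ → Forest → List Sym × List Sym
encode n k F with Any.any? (good? n k F) (candidates n k)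
... | yes found = proj₁ (find found)
... | no _ = [] , []

good⇒IsDCP : ∀ n k F σ → σ ∈ candidates n k → Good n k F σ → IsDCP n k σ
good⇒IsDCP n k F (S₁ , S₂) σ∈ ((start₁ , start₂ , dec₁ , dec₂) , _) =
  isDCP (candidates-↭ n k _ σ∈) start₁ start₂ dec₁ dec₂

IsDCP⇒good : ∀ n k F σ → IsDCP n k σ → Encodes n k F σ → σ ∈ candidates n k × Good n k F σ
IsDCP⇒good n k F (S₁ , S₂) (isDCP perm start₁ start₂ dec₁ dec₂) encodes =
  candidates-complete n k S₁ S₂ perm , (start₁ , start₂ , dec₁ , dec₂) , encodes

good-exists : ∀ n k F → IsDAT n k F → ∃ λ σ → σ ∈ candidates n k × Good n k F σ
good-exists n k F D
  with decode-surjective _ (blue₀ ∷ allSyms n k) refl (Unique-∷⁺ (blue₀∉allSyms n k) (allSyms-unique n k))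
                         (joinedParent F) (IsDAT⇒IsTree D)
... | w , valid , w↭ , decode≗ with ValidWord⇒IsDCP n k w valid w↭
...   | σ , dcp , refl = σ , IsDCP⇒good n k F σ dcp (All.tabulate encodes)
  where
    encodes : ∀ {v} → v ∈ allSyms n k → parent F v ≡ decode (join σ) v
    encodes {v} v∈ = sym (trans (decode≗ v) (setParent-other (parent F) blue₀ red₀ v (λ { refl → blue₀∉allSyms n k v∈ })))

encode-good : ∀ n k F → IsDAT n k F → encode n k F ∈ candidates n k × Good n k F (encode n k F)
encode-good n k F D with Any.any? (good? n k F) (candidates n k)
... | yes found = proj₂ (find found)
... | no none = let (σ , σ∈ , good) = good-exists n k F D in ⊥-elim (none (lose σ∈ good))

encode-IsDCP : ∀ n k F → IsDAT n k F → IsDCP n k (encode n k F)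
encode-IsDCP n k F D = let (σ∈ , good) = encode-good n k F D in good⇒IsDCP n k F _ σ∈ good

encode-encodes : ∀ n k F → IsDAT n k F → Encodes n k F (encode n k F)
encode-encodes n k F D = proj₂ (proj₂ (encode-good n k F D))

forest-ext : ∀ n k F₁ F₂ → IsDAT n k F₁ → IsDAT n k F₂ →
             (∀ v → v ∈ allSyms n k → parent F₁ v ≡ parent F₂ v) → F₁ ≡ F₂
forest-ext n k (forest r₁ b₁) (forest r₂ b₂) D₁ D₂ agree =
  cong₂ forest (nth-ext r₁ r₂ (trans (IsDAT.lenR D₁) (sym (IsDAT.lenR D₂)))
                  (λ i i< → agree (red (suc i)) (red∈allSyms n k (oneTo⁺ (s≤s z≤n) (subst (suc i ≤_) (IsDAT.lenR D₁) i<)))))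
               (nth-ext b₁ b₂ (trans (IsDAT.lenB D₁) (sym (IsDAT.lenB D₂)))
                  (λ j j< → agree (blue (suc j)) (blue∈allSyms n k (oneTo⁺ (s≤s z≤n) (subst (suc j ≤_) (IsDAT.lenB D₁) j<)))))

encode-injective : ∀ n k F₁ F₂ → IsDAT n k F₁ → IsDAT n k F₂ → encode n k F₁ ≡ encode n k F₂ → F₁ ≡ F₂
encode-injective n k F₁ F₂ D₁ D₂ e = forest-ext n k F₁ F₂ D₁ D₂ λ v v∈ → begin
  parent F₁ v                        ≡⟨ All.lookup (encode-encodes n k F₁ D₁) v∈ ⟩
  decode (join (encode n k F₁)) v    ≡⟨ cong (λ σ → decode (join σ) v) e ⟩
  decode (join (encode n k F₂)) v    ≡⟨ sym (All.lookup (encode-encodes n k F₂ D₂) v∈) ⟩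
  parent F₂ v                        ∎

module _ {q V} (tree : IsTree q V) where
  open IsTree tree

  IsTree-outside : ∀ v → v ∉ V → q v ≡ nothing
  IsTree-outside v v∉ with q v in e
  ... | nothing = refl
  ... | just u = ⊥-elim (v∉ (dom v u e))

  -- blue₀ has index 0, so it has no grandparent.
  IsTree-blue₀ : blue₀ ∈ V → q blue₀ ≡ just red₀
  IsTree-blue₀ b∈ with IsTree-total tree blue₀ b∈
  ... | u , e with rng blue₀ u e
  ...   | inj₁ refl = e
  ...   | inj₂ u∈ = case grandparent< blue₀ u _ e (proj₂ (IsTree-total tree u u∈)) of λ ()

joinedTree-ext : ∀ {n k q q′} → IsTree q (blue₀ ∷ allSyms n k) → IsTree q′ (blue₀ ∷ allSyms n k) →
                 (∀ v → v ∈ allSyms n k → q v ≡ q′ v) → ∀ v → q v ≡ q′ v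
joinedTree-ext {n} {k} t t′ agree v with Any.any? (v ≟ˢ_) (allSyms n k) | v ≟ˢ blue₀
... | yes v∈ | _ = agree v v∈
... | no _ | yes refl = trans (IsTree-blue₀ t (here refl)) (sym (IsTree-blue₀ t′ (here refl)))
... | no v∉ | no v≢blue₀ = trans (IsTree-outside t v v∉′) (sym (IsTree-outside t′ v v∉′))
  where
    v∉′ : v ∉ blue₀ ∷ allSyms n k
    v∉′ (here v≡blue₀) = v≢blue₀ v≡blue₀
    v∉′ (there v∈) = v∉ v∈

decode-IsTree : ∀ n k σ → IsDCP n k σ → IsTree (decode (join σ)) (blue₀ ∷ allSyms n k)
decode-IsTree n k σ d = record
  { dom = λ v u e → ∈-resp-↭ joined (dom v u e)
  ; rng = λ v u e → map₂ (∈-resp-↭ joined) (rng v u e)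
  ; alternating = alternating
  ; grandparent< = grandparent<
  ; rooted = λ v v∈ → rooted v (∈-resp-↭ (↭-sym joined) v∈)
  ; root∉ = λ { (here ()) ; (there r∈) → red₀∉allSyms n k r∈ } }
  where
    open IsTree (DecodeInvariant.tree (decodeInvariant (join σ) (IsDCP⇒ValidWord n k σ d)))
    joined = join-↭ n k (proj₁ σ) (proj₂ σ) (IsDCP.perm d)

encode-surjective : ∀ n k σ → IsDCP n k σ → ∃ λ F → IsDAT n k F × encode n k F ≡ σ
encode-surjective n k σ@(S₁ , S₂) d = F , D , σ′≡σ
  where
    tree = decode-IsTree n k σ d
    F = splitForest n k (decode (join σ))
    D = IsTree⇒IsDAT tree
    σ′ = encode n k F
    d′ = encode-IsDCP n k F D
    same : ∀ v → v ∈ allSyms n k → decode (join σ′) v ≡ decode (join σ) v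
    same v v∈ = begin
      decode (join σ′) v                      ≡⟨ sym (All.lookup (encode-encodes n k F D) v∈) ⟩
      parent F v                              ≡⟨ parent-splitForest tree v ⟩
      unsetParent (decode (join σ)) blue₀ v   ≡⟨ unsetParent-other _ blue₀ v (λ { refl → blue₀∉allSyms n k v∈ }) ⟩
      decode (join σ) v                       ∎
    σ′≡σ : σ′ ≡ σ
    σ′≡σ = join-injective (proj₁ σ′) (proj₂ σ′) S₁ S₂ (blue₀∉S₁ n k _ _ d′) (blue₀∉S₁ n k S₁ S₂ d)
             (decode-injective (join σ′) (IsDCP⇒ValidWord n k σ′ d′) (join σ) (IsDCP⇒ValidWord n k σ d)
               (joinedTree-ext {n} {k} (decode-IsTree n k σ′ d′) tree same))

nonEmpty : List Sym → Bool
nonEmpty [] = false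
nonEmpty (_ ∷ _) = true

blueRunEnds-∷-++ : ∀ a As y Bs → blueRunEnds (a ∷ As ++ y ∷ Bs) ≡ blueRunEnds ((a ∷ As) ∷ʳ y) ++ blueRunEnds (y ∷ Bs)
blueRunEnds-∷-++ a [] y Bs with isBlue a ∧ not (isBlue y)
... | true = refl
... | false = refl
blueRunEnds-∷-++ a (a′ ∷ As) y Bs with isBlue a ∧ not (isBlue a′)
... | true = cong (a ∷_) (blueRunEnds-∷-++ a′ As y Bs)
... | false = blueRunEnds-∷-++ a′ As y Bs

blueRunEnds-++ : ∀ As y Bs → blueRunEnds (As ++ y ∷ Bs) ≡ blueRunEnds (As ∷ʳ y) ++ blueRunEnds (y ∷ Bs)
blueRunEnds-++ [] y Bs = refl
blueRunEnds-++ (a ∷ As) y Bs = blueRunEnds-∷-++ a As y Bs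

blueRunEnds-⊆ : ∀ L {y} → y ∈ blueRunEnds L → y ∈ L × isBlue y ≡ true
blueRunEnds-⊆ (a ∷ b ∷ L) {y} y∈ with isBlue a ∧ not (isBlue b) in ends | blueRunEnds-⊆ (b ∷ L) {y}
... | true | ih = [ (λ y≡a → here y≡a , subst (λ z → isBlue z ≡ true) (sym y≡a) (proj₁ (∧-true ends))) ,
                     map₁ there ∘ ih ]′ (Any.toSum y∈)
... | false | ih = map₁ there (ih y∈)

Positive : Maybe ℕ → Set
Positive m = ∀ {a} → m ≡ just a → 0 < a

runningMin-pos : ∀ m L → All (0 <_) L → Positive m → Positive (runningMin m L)
runningMin-pos m [] _ pos = pos
runningMin-pos nothing (x ∷ L) (x>0 ∷ L>0) _ = runningMin-pos (just x) L L>0 λ { refl → x>0 }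
runningMin-pos (just a) (x ∷ L) (x>0 ∷ L>0) pos with x <ᵇ a
... | true = runningMin-pos (just x) L L>0 λ { refl → x>0 }
... | false = runningMin-pos (just a) L L>0 pos

-- Index 0 beats every positive running minimum, and nothing beats it afterwards.
lrMinAux-0∷ : ∀ m L → Positive m → lrMinAux m (0 ∷ L) ≡ 1
lrMinAux-0∷ nothing L _ = cong suc (lrMinAux-zero L)
lrMinAux-0∷ (just a) L pos rewrite <⇒<ᵇ-true (pos refl) = cong suc (lrMinAux-zero L)

idx-pos : ∀ a → a ≢ red₀ → a ≢ blue₀ → 0 < idx a
idx-pos (red zero) a≢red₀ _ = ⊥-elim (a≢red₀ refl)
idx-pos (red (suc i)) _ _ = s≤s z≤n
idx-pos (blue zero) _ a≢blue₀ = ⊥-elim (a≢blue₀ refl)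
idx-pos (blue (suc j)) _ _ = s≤s z≤n

blueRecords-join : ∀ n k S₁ S₂ → IsDCP n k (S₁ , S₂) → blueRecords (join (S₁ , S₂)) ≡ blueRecords S₁ + toℕ (nonEmpty S₂)
blueRecords-join n k S₁ S₂ d = begin
  blueRecords (join (S₁ , S₂))
    ≡⟨ cong (lrMinAux nothing ∘ map idx) (trans (blueRunEnds-++ S₁ blue₀ S₂) (cong (_++ blueRunEnds (blue₀ ∷ S₂)) endsS₁)) ⟩
  lrMinAux nothing (map idx (blueRunEnds S₁ ++ blueRunEnds (blue₀ ∷ S₂)))
    ≡⟨ cong (lrMinAux nothing) (LP.map-++ idx (blueRunEnds S₁) (blueRunEnds (blue₀ ∷ S₂))) ⟩
  lrMinAux nothing (map idx (blueRunEnds S₁) ++ map idx (blueRunEnds (blue₀ ∷ S₂)))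
    ≡⟨ lrMinAux-++ nothing (map idx (blueRunEnds S₁)) (map idx (blueRunEnds (blue₀ ∷ S₂))) ⟩
  blueRecords S₁ + lrMinAux (blueMin S₁) (map idx (blueRunEnds (blue₀ ∷ S₂)))
    ≡⟨ cong (blueRecords S₁ +_) (afterBlue₀ S₂ (IsDCP.start₂ d)) ⟩
  blueRecords S₁ + toℕ (nonEmpty S₂) ∎
  where
    endsS₁ : blueRunEnds (S₁ ∷ʳ blue₀) ≡ blueRunEnds S₁
    endsS₁ = trans (blueRunEnds-∷ʳᵐ S₁ blue₀) (trans (cong (blueRunEnds S₁ ++_) (blueRunEndᵐ-blue (lastM S₁) 0)) (++-identityʳ _))
    positive : Positive (blueMin S₁)
    positive = runningMin-pos nothing (map idx (blueRunEnds S₁)) (Allₚ.map⁺ (All.tabulate pos)) (λ ())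
      where
        pos : ∀ {y} → y ∈ blueRunEnds S₁ → 0 < idx y
        pos {y} y∈ with blueRunEnds-⊆ S₁ y∈
        ... | y∈S₁ , y-blue = idx-pos y (λ { refl → case y-blue of λ () }) (λ { refl → blue₀∉S₁ n k S₁ S₂ d y∈S₁ })
    afterBlue₀ : ∀ S₂ → StartsWith R S₂ → lrMinAux (blueMin S₁) (map idx (blueRunEnds (blue₀ ∷ S₂))) ≡ toℕ (nonEmpty S₂)
    afterBlue₀ [] _ = refl
    afterBlue₀ (red i ∷ S₂) _ = lrMinAux-0∷ (blueMin S₁) _ positive

ValidWord-++⁻ : ∀ As Bs → ValidWord (As ++ Bs) → ValidWord As
ValidWord-++⁻ As Bs (validWord u r∉ dec st) =
  validWord (Unique-++ˡ As u) (r∉ ∘ ∈-++⁺ˡ) (RunsDecreasing-++ˡ As Bs dec) (StartsWith-++ˡ As Bs st)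

decode-++ : ∀ w₂ w {v} → Unique (w ++ w₂) → v ∈ w → decode (w ++ w₂) v ≡ decode w v
decode-++ [] w _ _ = cong (λ z → decode z _) (++-identityʳ w)
decode-++ (x ∷ w₂) w {v} u v∈ = begin
  decode (w ++ x ∷ w₂) v    ≡⟨ cong (λ z → decode z v) (sym (LP.++-assoc w (x ∷ []) w₂)) ⟩
  decode (w ∷ʳ x ++ w₂) v   ≡⟨ decode-++ w₂ (w ∷ʳ x) (subst Unique (sym (LP.++-assoc w (x ∷ []) w₂)) u) (∈-++⁺ˡ v∈) ⟩
  decode (w ∷ʳ x) v         ≡⟨ cong (λ f → f v) (decode-∷ʳ w x) ⟩
  setParent (decode w) x _ v ≡⟨ setParent-other _ x _ v (λ { refl → proj₂ (Unique-mid⁻ w w₂ u) (∈-++⁺ˡ v∈) }) ⟩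
  decode w v                ∎

spineAfter-blue₀ : ∀ s → All (λ a → 0 < idx a) s → spineAfter blue₀ red₀ s ≡ blue₀ ∷ []
spineAfter-blue₀ [] _ = refl
spineAfter-blue₀ (a ∷ s) (a>0 ∷ _) rewrite <⇒<ᵇ-true a>0 = refl

-- A nonempty S₂ starts with a red letter, which is inserted right under blue₀.
blue₀-hasRedChild : ∀ n k S₁ S₂ → IsDCP n k (S₁ , S₂) →
                    anyB (λ i → decode (join (S₁ , S₂)) (red i) ==ₘ just blue₀) (oneTo n) ≡ nonEmpty S₂
blue₀-hasRedChild n k S₁ [] d = anyB-false _ (oneTo n) (λ i → ≢⇒==ₘ-false (blue₀-childless (red i)))
  where
    I = decodeInvariant _ (IsDCP⇒ValidWord n k (S₁ , []) d)
    endsAtBlue₀ = last≡just⇒∷ʳ (spine (join (S₁ , []))) (trans (DecodeInvariant.spine-last I) (last-∷ʳ S₁ blue₀))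
    blue₀-childless = proj₂ (SmallestChildPath-end (proj₁ endsAtBlue₀)
                        (subst (SmallestChildPath _ red₀) (proj₂ endsAtBlue₀) (DecodeInvariant.spine-path I)))
blue₀-hasRedChild n k S₁ (red i ∷ S₂) d =
  anyB-true _ (oneTo n) i∈ (trans (cong (_==ₘ just blue₀) parent≡) (==ₘ-refl (just blue₀)))
  where
    i∈ : i ∈ oneTo n
    i∈ with allSyms⁻ n k (∈-resp-↭ (IsDCP.perm d) (∈-++⁺ʳ S₁ (here refl)))
    ... | inj₁ (_ , refl , i∈) = i∈
    w₁ = (S₁ ∷ʳ blue₀) ∷ʳ red i
    w₁≡ : join (S₁ , red i ∷ S₂) ≡ w₁ ++ S₂
    w₁≡ = trans (sym (LP.++-assoc S₁ (blue₀ ∷ red i ∷ []) S₂))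
                (cong (_++ S₂) (sym (LP.++-assoc S₁ (blue₀ ∷ []) (red i ∷ []))))
    spineS₁>0 : All (λ a → 0 < idx a) (spine S₁)
    spineS₁>0 = All.tabulate λ {a} a∈ → allSyms-idx-pos n k (∈-resp-↭ (IsDCP.perm d) (∈-++⁺ˡ (DecodeInvariant.spine-⊆ I₁ a a∈)))
      where I₁ = decodeInvariant S₁ (ValidWord-++⁻ S₁ (blue₀ ∷ red i ∷ S₂) (IsDCP⇒ValidWord n k _ d))
    parent≡ : decode (join (S₁ , red i ∷ S₂)) (red i) ≡ just blue₀
    parent≡ = begin
      decode (join (S₁ , red i ∷ S₂)) (red i) ≡⟨ cong (λ z → decode z (red i)) w₁≡ ⟩
      decode (w₁ ++ S₂) (red i)              ≡⟨ decode-++ S₂ w₁ (subst Unique w₁≡ (ValidWord.unique (IsDCP⇒ValidWord n k _ d)))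
                                                   (∈-++⁺ʳ (S₁ ∷ʳ blue₀) (here refl)) ⟩
      decode w₁ (red i)                       ≡⟨ cong (λ f → f (red i)) (decode-∷ʳ (S₁ ∷ʳ blue₀) (red i)) ⟩
      setParent _ (red i) (attachPoint (red i) red₀ (spine (S₁ ∷ʳ blue₀))) (red i) ≡⟨ setParent-self _ (red i) _ ⟩
      just (attachPoint (red i) red₀ (spine (S₁ ∷ʳ blue₀)))
        ≡⟨ cong (just ∘ attachPoint (red i) red₀) (trans (spine-∷ʳ S₁ blue₀) (spineAfter-blue₀ (spine S₁) spineS₁>0)) ⟩
      just blue₀                              ∎

innerRootChildren-join : ∀ n k F σ → IsDCP n k σ → Encodes n k F σ →
                         innerRootChildren n k (decode (join σ)) ≡ toℕ (nonEmpty (proj₂ σ)) + wch n k F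
innerRootChildren-join n k F σ@(S₁ , S₂) d encodes =
  trans (countB-∷ (innerRootChild n q) 0 (oneTo k)) (cong₂ _+_ (cong toℕ blue₀-inner) others)
  where
    q = decode (join σ)
    blue₀-inner : innerRootChild n q 0 ≡ nonEmpty S₂
    blue₀-inner rewrite IsTree-blue₀ (decode-IsTree n k σ d) (here refl) = blue₀-hasRedChild n k S₁ S₂ d
    parent≡ : ∀ {v} → v ∈ allSyms n k → q v ≡ parent F v
    parent≡ v∈ = sym (All.lookup encodes v∈)
    others : countB (innerRootChild n q) (oneTo k) ≡ wch n k F
    others = countB-cong (oneTo k) λ j j∈ →
      cong₂ _∧_ (cong (_==ₘ just red₀) (parent≡ (blue∈allSyms n k j∈)))
                (anyB-cong (oneTo n) (λ i i∈ → cong (_==ₘ just (blue j)) (parent≡ (red∈allSyms n k i∈))))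

-- blue₀ contributes one record to the word and one inner child of red₀ exactly when S₂ is nonempty.
weight-preserved : ∀ n k F σ → IsDCP n k σ → Encodes n k F σ → wlr σ ≡ wch n k F
weight-preserved n k F σ@(S₁ , S₂) d encodes = +-cancelˡ-≡ (toℕ (nonEmpty S₂)) _ _ (begin
  toℕ (nonEmpty S₂) + wlr σ                          ≡⟨ cong (toℕ (nonEmpty S₂) +_) wlr≡ ⟩
  toℕ (nonEmpty S₂) + blueRecords S₁                 ≡⟨ +-comm (toℕ (nonEmpty S₂)) (blueRecords S₁) ⟩
  blueRecords S₁ + toℕ (nonEmpty S₂)                 ≡⟨ sym (blueRecords-join n k S₁ S₂ d) ⟩
  blueRecords (join σ)                               ≡⟨ proj₂ (weightInvariant n k (join σ) (IsDCP⇒ValidWord n k σ d) inRange) ⟩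
  innerRootChildren n k (decode (join σ))            ≡⟨ innerRootChildren-join n k F σ d encodes ⟩
  toℕ (nonEmpty S₂) + wch n k F                      ∎)
  where
    wlr≡ : wlr σ ≡ blueRecords S₁
    wlr≡ = cong (lrMinAux nothing) (blueRunMinima S₁ (IsDCP.dec₁ d))
    inRange : ∀ v → v ∈ join σ → InRange n k v
    inRange v v∈ = InRange-allSyms n k v (∈-resp-↭ (join-↭ n k S₁ S₂ (IsDCP.perm d)) v∈)

theorem3p7 : (n k : ℕ) →
    Σ (Forest → List Sym × List Sym) λ g →
    ((λ₀ : Forest) → IsDAT n k λ₀ → IsDCP n k (g λ₀))
    × ((λ₁ λ₂ : Forest) → IsDAT n k λ₁ → IsDAT n k λ₂ → g λ₁ ≡ g λ₂ → λ₁ ≡ λ₂)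
    × ((σ : List Sym × List Sym) → IsDCP n k σ → ∃ λ λ₀ → IsDAT n k λ₀ × g λ₀ ≡ σ)
    × ((λ₀ : Forest) → IsDAT n k λ₀ → wlr (g λ₀) ≡ wch n k λ₀)
theorem3p7 n k =
  encode n k , encode-IsDCP n k , encode-injective n k , encode-surjective n k ,
  λ F D → weight-preserved n k F (encode n k F) (encode-IsDCP n k F D) (encode-encodes n k F D)
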